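{- $\mathbf{CLA4}$ proves $\sqcap x\sqcap y\sqcup z\,(z=x+y)$.
   Context: Language of $\mathbf{CLA4}$. Terms are built from variables, the constant $0$, unary $'$ (successor), binary $+$, $\times$; atomic formulas are $\tau_1=\tau_2$. Formulas are built from atoms with $\top,\bot$, $\neg$ (officially applied only to atoms; elsewhere via De Morgan laws and double negation), $\wedge,\vee$, choice connectives $\sqcap,\sqcup$, and quantifiers $\forall,\exists$ (blind) and $\sqcap x,\sqcup x$ (choice). $E\to F$ abbreviates $\neg E\vee F$. Elementary formulas are those without $\sqcap,\sqcup$ (formulas of Peano arithmetic $\mathbf{PA}$). $\tau 0$ abbreviates $0''\times\tau$ and $\tau1$ abbreviates $(0''\times\tau)'$. $|x|$ denotes the length $\lceil\log_2(x+1)\rceil$ of the binary numeral of $x$; expressions involving $|x|$ abbreviate standard $\mathbf{PA}$ formulas. A polynomial sizebound for $x$ is a $\mathbf{PA}$ formula expressing $|x|\le\tau(|y_1|,\ldots,|y_n|)$, with the $y_i$ variables other than $x$ and $\tau$ built from $0,',+,\times$. A formula is polynomially bounded iff each subformula $\sqcap xG(x)$ has $G(x)$ of the form $S(x)\to H(x)$ and each subformula $\sqcup xG(x)$ has $G(x)$ of the form $S(x)\wedge H(x)$, $S(x)$ a polynomial sizebound for $x$. The $\sqcap$-closure ($\forall$-closure) prefixes $\sqcap$ ($\forall$) over all free variables. Logic $\mathbf{CL12}$. A sequent is $E_1,\ldots,E_n\circ\!\!-F$. The elementarization $\|F\|$ replaces every $\sqcup$- and $\sqcup x$-subformula by $\bot$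 and every $\sqcap$- and $\sqcap x$-subformula by $\top$; the elementarization of a sequent is $\|E_1\|\wedge\ldots\wedge\|E_n\|\to\|F\|$; a sequent is stable iff its elementarization is classically valid (first-order logic with identity). A surface occurrence is one not in the scope of a choice operator; $F[E]$ denotes a formula with a fixed surface occurrence of $E$. Rules ($i\in\{0,1\}$; $\mathfrak t$ a constant or a variable not bound in the premise): $\sqcup$-Choose: $\vec G\circ\!\!-F[H_i]\,/\,\vec G\circ\!\!-F[H_0\sqcup H_1]$; $\sqcap$-Choose: $\vec G,E[H_i],\vec K\circ\!\!-F\,/\,\vec G,E[H_0\sqcap H_1],\vec K\circ\!\!-F$; $\sqcup x$-Choose: $\vec G\circ\!\!-F[H(\mathfrak t)]\,/\,\vec G\circ\!\!-F[\sqcup xH(x)]$; $\sqcap x$-Choose: $\vec G,E[H(\mathfrak t)],\vec K\circ\!\!-F\,/\,\vec G,E[\sqcap xH(x)],\vec K\circ\!\!-F$; Replicate: $\vec G,E,\vec K,E\circ\!\!-F\,/\,\vec G,E,\vec K\circ\!\!-F$; Wait: from $Y_1,\ldots,Y_n$ ($n\ge0$) infer a stable $X$ provided: if $X$ is $\vec G\circ\!\!-F[H_0\sqcap H_1]$ then $\vec G\circ\!\!-F[H_0]$, $\vec G\circ\!\!-F[H_1]$ are among the $Y_j$; if $X$ is $\vec G,E[H_0\sqcup H_1],\vec K\circ\!\!-F$ then $\vec G,E[H_0],\vec K\circ\!\!-F$, $\vec G,E[H_1],\vec K\circ\!\!-F$ are among the $Y_j$; if $X$ is $\vec G\circ\!\!-F[\sqcap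 xH(x)]$ then $\vec G\circ\!\!-F[H(y)]$ is among the $Y_j$ for some $y$ not in $X$; if $X$ is $\vec G,E[\sqcup xH(x)],\vec K\circ\!\!-F$ then $\vec G,E[H(y)],\vec K\circ\!\!-F$ is among the $Y_j$ for some $y$ not in $X$. System $\mathbf{CLA4}$. Axioms: $\forall x(0\neq x')$; $\forall x\forall y(x'=y'\to x=y)$; $\forall x(x+0=x)$; $\forall x\forall y(x+y'=(x+y)')$; $\forall x(x\times0=0)$; $\forall x\forall y(x\times y'=(x\times y)+x)$; the $\forall$-closure of $F(0)\wedge\forall x(F(x)\to F(x'))\to\forall xF(x)$ for each elementary $F(x)$; $\sqcap x\sqcup y(y=x')$; $\sqcap x\sqcup y(y=x0)$. Rules: Logical Consequence (from sentences $E_1,\ldots,E_n$ infer a sentence $F$ whenever $\mathbf{CL12}$ proves $E_1,\ldots,E_n\circ\!\!-F$), and $\mathbf{CLA4}$-Induction: from the $\sqcap$-closures of $F(0)$, $F(x)\to F(x0)$, $F(x)\to F(x1)$ infer the $\sqcap$-closure of $F(x)$, for polynomially bounded $F(x)$. A sentence is provable in $\mathbf{CLA4}$ iff there is a finite sequence of sentences, each an axiom or obtained from earlier ones by a rule, ending with it. -}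

module Defs where

open import Data.Nat using (ℕ; zero; suc; _+_; _*_; _≤_; _≟_)
open import Data.Nat.Logarithm using (⌈log₂_⌉)
open import Data.List using (List; []; _∷_; _++_; foldr; deduplicate)
open import Data.List.Membership.Propositional using (_∈_; _∉_)
open import Data.List.Relation.Unary.All using (All)
open import Data.Product using (Σ; _×_; _,_)
open import Data.Sum using (_⊎_)
open import Data.Bool using (Bool; true; false)
open import Data.Unit using () renaming (⊤ to Unit)
open import Data.Empty using () renaming (⊥ to Empty)
open import Relation.Nullary using (¬_; yes; no)
open import Relation.Binary.PropositionalEquality using (_≡_)
open import Function.Bundles using (_⇔_)

Var : Set
Var = ℕ

data Term : Set where
  var  : Var → Term
  `0   : Term
  _′   : Term → Term
  _`+_ : Term → Term → Term
  _`×_ : Term → Term → Term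

infixl 8 _′
infixl 6 _`+_
infixl 7 _`×_

-- Formulas in negation normal form: negation is applied only to atoms.
data Formula : Set where
  `⊤ `⊥  : Formula
  _≐_    : Term → Term → Formula
  _≠_    : Term → Term → Formula
  _`∧_ _`∨_ : Formula → Formula → Formula
  _⊓_ _⊔_   : Formula → Formula → Formula
  `∀ `∃     : Var → Formula → Formula
  ⊓x ⊔x     : Var → Formula → Formula

infix 5 _≐_ _≠_
infixr 4 _`∧_ _⊓_
infixr 3 _`∨_ _⊔_

`¬ : Formula → Formula
`¬ `⊤ = `⊥
`¬ `⊥ = `⊤
`¬ (a ≐ b) = a ≠ b
`¬ (a ≠ b) = a ≐ b
`¬ (A `∧ B) = `¬ A `∨ `¬ B
`¬ (A `∨ B) = `¬ A `∧ `¬ B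
`¬ (A ⊓ B) = `¬ A ⊔ `¬ B
`¬ (A ⊔ B) = `¬ A ⊓ `¬ B
`¬ (`∀ x A) = `∃ x (`¬ A)
`¬ (`∃ x A) = `∀ x (`¬ A)
`¬ (⊓x x A) = ⊔x x (`¬ A)
`¬ (⊔x x A) = ⊓x x (`¬ A)

_⇒_ : Formula → Formula → Formula
A ⇒ B = `¬ A `∨ B
infixr 2 _⇒_

_·0 : Term → Term
t ·0 = (`0 ′ ′) `× t

_·1 : Term → Term
t ·1 = ((`0 ′ ′) `× t) ′

varsT : Term → List Var
varsT (var x) = x ∷ []
varsT `0 = []
varsT (t ′) = varsT t
varsT (s `+ t) = varsT s ++ varsT t
varsT (s `× t) = varsT s ++ varsT t

remove : Var → List Var → List Var
remove x [] = []
remove x (y ∷ ys) with x ≟ y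
... | yes _ = remove x ys
... | no _  = y ∷ remove x ys

-- free variables (possibly with repetitions)
fv : Formula → List Var
fv `⊤ = []
fv `⊥ = []
fv (a ≐ b) = varsT a ++ varsT b
fv (a ≠ b) = varsT a ++ varsT b
fv (A `∧ B) = fv A ++ fv B
fv (A `∨ B) = fv A ++ fv B
fv (A ⊓ B) = fv A ++ fv B
fv (A ⊔ B) = fv A ++ fv B
fv (`∀ x A) = remove x (fv A)
fv (`∃ x A) = remove x (fv A)
fv (⊓x x A) = remove x (fv A)
fv (⊔x x A) = remove x (fv A)

bv : Formula → List Var
bv `⊤ = []
bv `⊥ = []
bv (a ≐ b) = []
bv (a ≠ b) = []
bv (A `∧ B) = bv A ++ bv B
bv (A `∨ B) = bv A ++ bv B
bv (A ⊓ B) = bv A ++ bv B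
bv (A ⊔ B) = bv A ++ bv B
bv (`∀ x A) = x ∷ bv A
bv (`∃ x A) = x ∷ bv A
bv (⊓x x A) = x ∷ bv A
bv (⊔x x A) = x ∷ bv A

allVars : Formula → List Var
allVars `⊤ = []
allVars `⊥ = []
allVars (a ≐ b) = varsT a ++ varsT b
allVars (a ≠ b) = varsT a ++ varsT b
allVars (A `∧ B) = allVars A ++ allVars B
allVars (A `∨ B) = allVars A ++ allVars B
allVars (A ⊓ B) = allVars A ++ allVars B
allVars (A ⊔ B) = allVars A ++ allVars B
allVars (`∀ x A) = x ∷ allVars A
allVars (`∃ x A) = x ∷ allVars A
allVars (⊓x x A) = x ∷ allVars A
allVars (⊔x x A) = x ∷ allVars A

Sentence : Formula → Set
Sentence F = fv F ≡ []

Elementary : Formula → Set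
Elementary `⊤ = Unit
Elementary `⊥ = Unit
Elementary (a ≐ b) = Unit
Elementary (a ≠ b) = Unit
Elementary (A `∧ B) = Elementary A × Elementary B
Elementary (A `∨ B) = Elementary A × Elementary B
Elementary (A ⊓ B) = Empty
Elementary (A ⊔ B) = Empty
Elementary (`∀ x A) = Elementary A
Elementary (`∃ x A) = Elementary A
Elementary (⊓x x A) = Empty
Elementary (⊔x x A) = Empty

substT : Var → Term → Term → Term
substT x t (var y) with x ≟ y
... | yes _ = t
... | no _  = var y
substT x t `0 = `0
substT x t (s ′) = substT x t s ′
substT x t (a `+ b) = substT x t a `+ substT x t b
substT x t (a `× b) = substT x t a `× substT x t b

substF : Var → Term → Formula → Formula
substF x t `⊤ = `⊤
substF x t `⊥ = `⊥
substF x t (a ≐ b) = substT x t a ≐ substT x t b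
substF x t (a ≠ b) = substT x t a ≠ substT x t b
substF x t (A `∧ B) = substF x t A `∧ substF x t B
substF x t (A `∨ B) = substF x t A `∨ substF x t B
substF x t (A ⊓ B) = substF x t A ⊓ substF x t B
substF x t (A ⊔ B) = substF x t A ⊔ substF x t B
substF x t (`∀ y A) with x ≟ y
... | yes _ = `∀ y A
... | no _  = `∀ y (substF x t A)
substF x t (`∃ y A) with x ≟ y
... | yes _ = `∃ y A
... | no _  = `∃ y (substF x t A)
substF x t (⊓x y A) with x ≟ y
... | yes _ = ⊓x y A
... | no _  = ⊓x y (substF x t A)
substF x t (⊔x y A) with x ≟ y
... | yes _ = ⊔x y A
... | no _  = ⊔x y (substF x t A)

freeVars : Formula → List Var
freeVars F = deduplicate _≟_ (fv F)

∀-closure : Formula → Formula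
∀-closure F = foldr `∀ F (freeVars F)

⊓-closure : Formula → Formula
⊓-closure F = foldr ⊓x F (freeVars F)

-- Classical (Tarskian) semantics, via the Gödel–Gentzen negative
-- translation so that it is faithful to classical truth.  Only used on elementary formulas; choice
-- operators are (arbitrarily) interpreted as false.

record Structure : Set₁ where
  field
    D    : Set
    zer  : D
    succ : D → D
    add  : D → D → D
    mul  : D → D → D

module _ (M : Structure) where
  open Structure M

  evalT : (Var → D) → Term → D
  evalT ρ (var x) = ρ x
  evalT ρ `0 = zer
  evalT ρ (t ′) = succ (evalT ρ t)
  evalT ρ (a `+ b) = add (evalT ρ a) (evalT ρ b)
  evalT ρ (a `× b) = mul (evalT ρ a) (evalT ρ b)

  update : (Var → D) → Var → D → (Var → D)
  update ρ x d y with x ≟ y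
  ... | yes _ = d
  ... | no _  = ρ y

  ⟦_⟧ : Formula → (Var → D) → Set
  ⟦ `⊤ ⟧ ρ = Unit
  ⟦ `⊥ ⟧ ρ = Empty
  ⟦ a ≐ b ⟧ ρ = ¬ ¬ (evalT ρ a ≡ evalT ρ b)
  ⟦ a ≠ b ⟧ ρ = ¬ (evalT ρ a ≡ evalT ρ b)
  ⟦ A `∧ B ⟧ ρ = ⟦ A ⟧ ρ × ⟦ B ⟧ ρ
  ⟦ A `∨ B ⟧ ρ = ¬ (¬ ⟦ A ⟧ ρ × ¬ ⟦ B ⟧ ρ)
  ⟦ A ⊓ B ⟧ ρ = Empty
  ⟦ A ⊔ B ⟧ ρ = Empty
  ⟦ `∀ x A ⟧ ρ = (d : D) → ⟦ A ⟧ (update ρ x d)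
  ⟦ `∃ x A ⟧ ρ = ¬ ((d : D) → ¬ ⟦ A ⟧ (update ρ x d))
  ⟦ ⊓x x A ⟧ ρ = Empty
  ⟦ ⊔x x A ⟧ ρ = Empty

Valid : Formula → Set₁
Valid F = (M : Structure) (ρ : Var → Structure.D M) → ⟦ M ⟧ F ρ

ℕ-Model : Structure
ℕ-Model = record { D = ℕ ; zer = zero ; succ = suc ; add = _+_ ; mul = _*_ }

∣_∣ : ℕ → ℕ
∣ n ∣ = ⌈log₂ (suc n) ⌉

_⊆ᵥ_ : List Var → List Var → Set
xs ⊆ᵥ ys = All (λ v → v ∈ ys) xs

SizeBound : Var → Formula → Set
SizeBound x S =
  Elementary S ×
  Σ Term (λ τ →
    (x ∉ varsT τ) ×
    (fv S ⊆ᵥ (x ∷ varsT τ)) ×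
    ((ρ : Var → ℕ) →
      ⟦ ℕ-Model ⟧ S ρ ⇔ (∣ ρ x ∣ ≤ evalT ℕ-Model (λ v → ∣ ρ v ∣) τ)))

PolyBounded : Formula → Set
PolyBounded `⊤ = Unit
PolyBounded `⊥ = Unit
PolyBounded (a ≐ b) = Unit
PolyBounded (a ≠ b) = Unit
PolyBounded (A `∧ B) = PolyBounded A × PolyBounded B
PolyBounded (A `∨ B) = PolyBounded A × PolyBounded B
PolyBounded (A ⊓ B) = PolyBounded A × PolyBounded B
PolyBounded (A ⊔ B) = PolyBounded A × PolyBounded B
PolyBounded (`∀ x A) = PolyBounded A
PolyBounded (`∃ x A) = PolyBounded A
PolyBounded (⊓x x G) =
  PolyBounded G ×
  Σ Formula (λ S → Σ Formula (λ H → (G ≡ (S ⇒ H)) × SizeBound x S))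
PolyBounded (⊔x x G) =
  PolyBounded G ×
  Σ Formula (λ S → Σ Formula (λ H → (G ≡ (S `∧ H)) × SizeBound x S))

record Sequent : Set where
  constructor _∘-_
  field
    ante : List Formula
    succ : Formula
infix 1 _∘-_

-- surface contexts F[ ] : the hole is not in the scope of a choice operator
data Ctx : Set where
  ∙    : Ctx
  _∧ₗ_ : Ctx → Formula → Ctx
  _∧ᵣ_ : Formula → Ctx → Ctx
  _∨ₗ_ : Ctx → Formula → Ctx
  _∨ᵣ_ : Formula → Ctx → Ctx
  ∀ᶜ ∃ᶜ : Var → Ctx → Ctx

_[_] : Ctx → Formula → Formula
∙ [ E ] = E
(C ∧ₗ G) [ E ] = C [ E ] `∧ G
(G ∧ᵣ C) [ E ] = G `∧ C [ E ]
(C ∨ₗ G) [ E ] = C [ E ] `∨ G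
(G ∨ᵣ C) [ E ] = G `∨ C [ E ]
∀ᶜ x C [ E ] = `∀ x (C [ E ])
∃ᶜ x C [ E ] = `∃ x (C [ E ])

∥_∥ : Formula → Formula
∥ `⊤ ∥ = `⊤
∥ `⊥ ∥ = `⊥
∥ a ≐ b ∥ = a ≐ b
∥ a ≠ b ∥ = a ≠ b
∥ A `∧ B ∥ = ∥ A ∥ `∧ ∥ B ∥
∥ A `∨ B ∥ = ∥ A ∥ `∨ ∥ B ∥
∥ A ⊓ B ∥ = `⊤
∥ A ⊔ B ∥ = `⊥
∥ `∀ x A ∥ = `∀ x ∥ A ∥
∥ `∃ x A ∥ = `∃ x ∥ A ∥
∥ ⊓x x A ∥ = `⊤
∥ ⊔x x A ∥ = `⊥

conjElem : List Formula → Formula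
conjElem [] = `⊤
conjElem (E ∷ []) = ∥ E ∥
conjElem (E ∷ Es@(_ ∷ _)) = ∥ E ∥ `∧ conjElem Es

elemSeq : Sequent → Formula
elemSeq ([] ∘- F) = ∥ F ∥
elemSeq (Es@(_ ∷ _) ∘- F) = conjElem Es ⇒ ∥ F ∥

Stable : Sequent → Set₁
Stable X = Valid (elemSeq X)

seqBound : Sequent → List Var
seqBound (Es ∘- F) = foldr (λ E vs → bv E ++ vs) (bv F) Es

seqVars : Sequent → List Var
seqVars (Es ∘- F) = foldr (λ E vs → allVars E ++ vs) (allVars F) Es

Admissible : Term → Sequent → Set
Admissible t X = (t ≡ `0) ⊎ Σ Var (λ v → (t ≡ var v) × (v ∉ seqBound X))

pick : Bool → Formula → Formula → Formula
pick false H₀ H₁ = H₀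
pick true  H₀ H₁ = H₁

data CL12⊢ : Sequent → Set₁ where
  ⊔-choose : ∀ Gs C H₀ H₁ (i : Bool) →
    CL12⊢ (Gs ∘- C [ pick i H₀ H₁ ]) →
    CL12⊢ (Gs ∘- C [ H₀ ⊔ H₁ ])
  ⊓-choose : ∀ Gs C H₀ H₁ Ks F (i : Bool) →
    CL12⊢ (Gs ++ C [ pick i H₀ H₁ ] ∷ Ks ∘- F) →
    CL12⊢ (Gs ++ C [ H₀ ⊓ H₁ ] ∷ Ks ∘- F)
  ⊔x-choose : ∀ Gs C x H t →
    Admissible t (Gs ∘- C [ substF x t H ]) →
    CL12⊢ (Gs ∘- C [ substF x t H ]) →
    CL12⊢ (Gs ∘- C [ ⊔x x H ])
  ⊓x-choose : ∀ Gs C x H t Ks F →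
    Admissible t (Gs ++ C [ substF x t H ] ∷ Ks ∘- F) →
    CL12⊢ (Gs ++ C [ substF x t H ] ∷ Ks ∘- F) →
    CL12⊢ (Gs ++ C [ ⊓x x H ] ∷ Ks ∘- F)
  replicate : ∀ Gs E Ks F →
    CL12⊢ (Gs ++ E ∷ Ks ++ E ∷ [] ∘- F) →
    CL12⊢ (Gs ++ E ∷ Ks ∘- F)
  wait : ∀ Es F →
    Stable (Es ∘- F) →
    (∀ C H₀ H₁ → F ≡ C [ H₀ ⊓ H₁ ] →
       CL12⊢ (Es ∘- C [ H₀ ]) × CL12⊢ (Es ∘- C [ H₁ ])) →
    (∀ Gs C H₀ H₁ Ks → Es ≡ Gs ++ C [ H₀ ⊔ H₁ ] ∷ Ks →
       CL12⊢ (Gs ++ C [ H₀ ] ∷ Ks ∘- F) × CL12⊢ (Gs ++ C [ H₁ ] ∷ Ks ∘- F)) →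
    (∀ C x H → F ≡ C [ ⊓x x H ] →
       Σ Var (λ y → (y ∉ seqVars (Es ∘- F)) ×
         CL12⊢ (Es ∘- C [ substF x (var y) H ]))) →
    (∀ Gs C x H Ks → Es ≡ Gs ++ C [ ⊔x x H ] ∷ Ks →
       Σ Var (λ y → (y ∉ seqVars (Es ∘- F)) ×
         CL12⊢ (Gs ++ C [ substF x (var y) H ] ∷ Ks ∘- F))) →
    CL12⊢ (Es ∘- F)

private
  x y : Term
  x = var 0
  y = var 1

data CLA4⊢ : Formula → Set₁ where
  ax-1 : CLA4⊢ (`∀ 0 (`0 ≠ x ′))
  ax-2 : CLA4⊢ (`∀ 0 (`∀ 1 ((x ′ ≐ y ′) ⇒ (x ≐ y))))
  ax-3 : CLA4⊢ (`∀ 0 (x `+ `0 ≐ x))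
  ax-4 : CLA4⊢ (`∀ 0 (`∀ 1 (x `+ y ′ ≐ (x `+ y) ′)))
  ax-5 : CLA4⊢ (`∀ 0 (x `× `0 ≐ `0))
  ax-6 : CLA4⊢ (`∀ 0 (`∀ 1 (x `× y ′ ≐ (x `× y) `+ x)))
  ax-ind : ∀ (F : Formula) (v : Var) → Elementary F →
    CLA4⊢ (∀-closure
      ((substF v `0 F `∧ `∀ v (F ⇒ substF v (var v ′) F)) ⇒ `∀ v F))
  ax-succ : CLA4⊢ (⊓x 0 (⊔x 1 (y ≐ x ′)))
  ax-double : CLA4⊢ (⊓x 0 (⊔x 1 (y ≐ x ·0)))
  logical-consequence : ∀ (Es : List Formula) (F : Formula) →
    All CLA4⊢ Es → All Sentence Es → Sentence F →
    CL12⊢ (Es ∘- F) → CLA4⊢ F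
  cla4-induction : ∀ (F : Formula) (v : Var) → PolyBounded F →
    CLA4⊢ (⊓-closure (substF v `0 F)) →
    CLA4⊢ (⊓-closure (F ⇒ substF v (var v ·0) F)) →
    CLA4⊢ (⊓-closure (F ⇒ substF v (var v ·1) F)) →
    CLA4⊢ (⊓-closure F)

module Submission where

-- Write |x| for binary length.  CLA4-induction on x first gives halving,
-- ⊓x ⊔h (|h| ≤ |x| ∧ (x = 2h ⊔ x = 2h + 1)).  Then, for parameters a and b, CLA4-induction on y
-- proves that x + y can be computed for every x with |x|, |x + y| ≤ |a| + |b|; these size
-- conditions make the formula polynomially bounded.  To add 2y + j to x, halve x = 2h + i, ask the
-- induction hypothesis for h + y (for (h + 1) + y when i = j = 1), double the answer and add i + j
-- when that is 1.  Taking a, b := x, y yields the theorem.  Every stability side condition is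
-- verified semantically, in an arbitrary structure satisfying the PA axioms and five instances of
-- induction, which are themselves axioms of CLA4.

open import Defs
open import Data.Nat using (ℕ; zero; suc; _+_; _≤_; _≟_)
open import Data.List using (List; []; _∷_; _++_; map)
open import Data.List.Membership.Propositional using (_∈_; _∉_)
open import Data.List.Membership.Propositional.Properties using (∈-++⁺ˡ; ∈-++⁺ʳ; ∈-map⁺)
open import Data.List.Membership.DecPropositional _≟_ using (_∈?_; _∉?_)
open import Data.List.Relation.Unary.Any using (here)
open import Data.List.Relation.Unary.All as All using (All; []; _∷_; all?)
open import Data.List.Relation.Unary.All.Properties using (++⁺)
open import Data.Product using (Σ; _×_; _,_; proj₁; proj₂)
open import Data.Sum using (inj₁; inj₂)
open import Data.Bool using (Bool; true; false)
open import Data.Unit using (tt)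
open import Data.Empty using (⊥-elim)
open import Function.Base using (_∘_)
open import Relation.Nullary using (¬_; Dec; yes; no)
open import Relation.Nullary.Decidable using (True; toWitness; _×-dec_)
open import Relation.Binary.PropositionalEquality using (_≡_; refl; sym; trans; cong; cong₂)
open import Relation.Binary.Bundles using (Setoid)
open import Function.Bundles using (_⇔_; mk⇔)
import Relation.Binary.Reasoning.Setoid as ≈-Reasoning
open import Level using (0ℓ)

module Classical (M : Structure) where

  ¬¬-stable : ∀ A ρ → ¬ ¬ ⟦ M ⟧ A ρ → ⟦ M ⟧ A ρ
  ¬¬-stable `⊤ ρ h = tt
  ¬¬-stable `⊥ ρ h = h λ ()
  ¬¬-stable (a ≐ b) ρ h = λ k → h λ z → z k
  ¬¬-stable (a ≠ b) ρ h = λ e → h λ z → z e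
  ¬¬-stable (A `∧ B) ρ h =
    ¬¬-stable A ρ (λ k → h (k ∘ proj₁)) , ¬¬-stable B ρ (λ k → h (k ∘ proj₂))
  ¬¬-stable (A `∨ B) ρ h = λ k → h λ z → z k
  ¬¬-stable (A ⊓ B) ρ h = h λ ()
  ¬¬-stable (A ⊔ B) ρ h = h λ ()
  ¬¬-stable (`∀ x A) ρ h = λ d → ¬¬-stable A _ λ k → h λ f → k (f d)
  ¬¬-stable (`∃ x A) ρ h = λ k → h λ z → z k
  ¬¬-stable (⊓x x A) ρ h = h λ ()
  ¬¬-stable (⊔x x A) ρ h = h λ ()

  ¬-sound : ∀ A ρ → ⟦ M ⟧ (`¬ A) ρ → ¬ ⟦ M ⟧ A ρ
  ¬-sound `⊤ ρ () a
  ¬-sound `⊥ ρ n ()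
  ¬-sound (a ≐ b) ρ n e = e n
  ¬-sound (a ≠ b) ρ n e = n e
  ¬-sound (A `∧ B) ρ n (a , b) = n ((λ na → ¬-sound A ρ na a) , (λ nb → ¬-sound B ρ nb b))
  ¬-sound (A `∨ B) ρ (na , nb) o = o (¬-sound A ρ na , ¬-sound B ρ nb)
  ¬-sound (A ⊓ B) ρ () a
  ¬-sound (A ⊔ B) ρ () a
  ¬-sound (`∀ x A) ρ n f = n λ d na → ¬-sound A _ na (f d)
  ¬-sound (`∃ x A) ρ f n = n λ d → ¬-sound A _ (f d)
  ¬-sound (⊓x x A) ρ () a
  ¬-sound (⊔x x A) ρ () a

  -- Choice formulas are false, and so are their negations: hence elementarity.
  ¬-complete : ∀ A ρ → Elementary A → ¬ ⟦ M ⟧ A ρ → ⟦ M ⟧ (`¬ A) ρ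
  ¬-complete `⊤ ρ e n = n tt
  ¬-complete `⊥ ρ e n = tt
  ¬-complete (a ≐ b) ρ e n = λ q → n λ k → k q
  ¬-complete (a ≠ b) ρ e n = n
  ¬-complete (A `∧ B) ρ (eA , eB) n (p , q) =
    n (¬¬-stable A ρ (p ∘ ¬-complete A ρ eA) , ¬¬-stable B ρ (q ∘ ¬-complete B ρ eB))
  ¬-complete (A `∨ B) ρ (eA , eB) n =
    ¬-complete A ρ eA (λ a → n λ z → proj₁ z a) , ¬-complete B ρ eB (λ b → n λ z → proj₂ z b)
  ¬-complete (`∀ x A) ρ e n f = n λ d → ¬¬-stable A _ (f d ∘ ¬-complete A _ e)
  ¬-complete (`∃ x A) ρ e n d = ¬-complete A _ e λ a → n λ f → f d a

  ⇒-intro : ∀ A B ρ → Elementary A → (⟦ M ⟧ A ρ → ⟦ M ⟧ B ρ) → ⟦ M ⟧ (A ⇒ B) ρ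
  ⇒-intro A B ρ e f (n , m) = n (¬-complete A ρ e (m ∘ f))

  ⇒-elim : ∀ A B ρ → ⟦ M ⟧ (A ⇒ B) ρ → ⟦ M ⟧ A ρ → ⟦ M ⟧ B ρ
  ⇒-elim A B ρ h a = ¬¬-stable B ρ λ nb → h ((λ na → ¬-sound A ρ na a) , nb)

elementary? : ∀ F → Dec (Elementary F)
elementary? `⊤ = yes tt
elementary? `⊥ = yes tt
elementary? (a ≐ b) = yes tt
elementary? (a ≠ b) = yes tt
elementary? (A `∧ B) = elementary? A ×-dec elementary? B
elementary? (A `∨ B) = elementary? A ×-dec elementary? B
elementary? (A ⊓ B) = no λ ()
elementary? (A ⊔ B) = no λ ()
elementary? (`∀ x A) = elementary? A
elementary? (`∃ x A) = elementary? A
elementary? (⊓x x A) = no λ ()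
elementary? (⊔x x A) = no λ ()

⇒-introᵈ : ∀ M A B ρ → {True (elementary? A)} →
  (⟦ M ⟧ A ρ → ⟦ M ⟧ B ρ) → ⟦ M ⟧ (A ⇒ B) ρ
⇒-introᵈ M A B ρ {e} = Classical.⇒-intro M A B ρ (toWitness e)

∨⇒⇒-intro : ∀ M ρ P A B G → {True (elementary? A)} → {True (elementary? B)} →
  (⟦ M ⟧ A ρ → ⟦ M ⟧ B ρ → ¬ ⟦ M ⟧ G ρ → ⟦ M ⟧ P ρ) → ⟦ M ⟧ (P `∨ (A ⇒ (B ⇒ G))) ρ
∨⇒⇒-intro M ρ P A B G {eA} {eB} f (¬P , ¬A⇒B⇒G) =
  ¬A⇒B⇒G (⇒-introᵈ M A (B ⇒ G) ρ {eA} λ a → ⇒-introᵈ M B G ρ {eB} λ b →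
    Classical.¬¬-stable M G ρ λ ¬G → ¬P (f a b ¬G))

∨-introˡ : ∀ {A B : Set} → A → ¬ (¬ A × ¬ B)
∨-introˡ a (¬a , _) = ¬a a

∨-introʳ : ∀ {A B : Set} → B → ¬ (¬ A × ¬ B)
∨-introʳ b (_ , ¬b) = ¬b b

elementary-∥∥ : ∀ A → Elementary ∥ A ∥
elementary-∥∥ `⊤ = tt
elementary-∥∥ `⊥ = tt
elementary-∥∥ (a ≐ b) = tt
elementary-∥∥ (a ≠ b) = tt
elementary-∥∥ (A `∧ B) = elementary-∥∥ A , elementary-∥∥ B
elementary-∥∥ (A `∨ B) = elementary-∥∥ A , elementary-∥∥ B
elementary-∥∥ (A ⊓ B) = tt
elementary-∥∥ (A ⊔ B) = tt
elementary-∥∥ (`∀ x A) = elementary-∥∥ A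
elementary-∥∥ (`∃ x A) = elementary-∥∥ A
elementary-∥∥ (⊓x x A) = tt
elementary-∥∥ (⊔x x A) = tt

elementary-conjElem : ∀ Es → Elementary (conjElem Es)
elementary-conjElem [] = tt
elementary-conjElem (E ∷ []) = elementary-∥∥ E
elementary-conjElem (E ∷ Es@(_ ∷ _)) = elementary-∥∥ E , elementary-conjElem Es

-- A record rather than a function type, so that Es and F are inferred by unification.
infix 1 _⊨∥_
record _⊨∥_ (Es : List Formula) (F : Formula) : Set₁ where
  constructor ⊨∥-intro
  field ⊨∥-elim : ∀ M ρ → ⟦ M ⟧ (conjElem Es) ρ → ⟦ M ⟧ ∥ F ∥ ρ
open _⊨∥_

stable-intro : ∀ Es F → Es ⊨∥ F → Stable (Es ∘- F)
stable-intro [] F (⊨∥-intro h) M ρ = h M ρ tt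
stable-intro Es@(_ ∷ _) F (⊨∥-intro h) M ρ =
  Classical.⇒-intro M (conjElem Es) ∥ F ∥ ρ (elementary-conjElem Es) (h M ρ)

conjElem-lookup : ∀ M ρ Gs E Ks → ⟦ M ⟧ (conjElem (Gs ++ E ∷ Ks)) ρ → ⟦ M ⟧ ∥ E ∥ ρ
conjElem-lookup M ρ [] E [] h = h
conjElem-lookup M ρ [] E (_ ∷ _) (h , _) = h
conjElem-lookup M ρ (G ∷ []) E Ks (_ , h) = conjElem-lookup M ρ [] E Ks h
conjElem-lookup M ρ (G ∷ Gs@(_ ∷ _)) E Ks (_ , h) = conjElem-lookup M ρ Gs E Ks h

false-antecedent : ∀ Gs {E Ks F} → (∀ M ρ → ¬ ⟦ M ⟧ ∥ E ∥ ρ) → Gs ++ E ∷ Ks ⊨∥ F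
false-antecedent Gs {E} {Ks} ¬E = ⊨∥-intro λ M ρ h → ⊥-elim (¬E M ρ (conjElem-lookup M ρ Gs E Ks h))

module _ {A : Set} (parts : Formula → List A) where

  private
    under : (Ctx → Ctx) → List (Ctx × A) → List (Ctx × A)
    under f = map λ (K , a) → f K , a

    ∈-under : ∀ f {K a xs} → (K , a) ∈ xs → (f K , a) ∈ under f xs
    ∈-under f = ∈-map⁺ (λ (K , a) → f K , a)

  occurrences strictOccurrences : Formula → List (Ctx × A)
  occurrences F = map (∙ ,_) (parts F) ++ strictOccurrences F
  strictOccurrences (B `∧ C) = under (_∧ₗ C) (occurrences B) ++ under (B ∧ᵣ_) (occurrences C)
  strictOccurrences (B `∨ C) = under (_∨ₗ C) (occurrences B) ++ under (B ∨ᵣ_) (occurrences C)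
  strictOccurrences (`∀ x B) = under (∀ᶜ x) (occurrences B)
  strictOccurrences (`∃ x B) = under (∃ᶜ x) (occurrences B)
  strictOccurrences _ = []

  private
    strict : ∀ {F o} → o ∈ strictOccurrences F → o ∈ occurrences F
    strict {F} = ∈-++⁺ʳ (map (∙ ,_) (parts F))

  occurrences-complete : ∀ C G {a} → a ∈ parts G → (C , a) ∈ occurrences (C [ G ])
  occurrences-complete ∙ G a∈ = ∈-++⁺ˡ (∈-map⁺ _ a∈)
  occurrences-complete (C ∧ₗ B) G a∈ = strict (∈-++⁺ˡ (∈-under (_∧ₗ B) (occurrences-complete C G a∈)))
  occurrences-complete (B ∧ᵣ C) G a∈ =
    strict (∈-++⁺ʳ (under (_∧ₗ (C [ G ])) (occurrences B)) (∈-under (B ∧ᵣ_) (occurrences-complete C G a∈)))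
  occurrences-complete (C ∨ₗ B) G a∈ = strict (∈-++⁺ˡ (∈-under (_∨ₗ B) (occurrences-complete C G a∈)))
  occurrences-complete (B ∨ᵣ C) G a∈ =
    strict (∈-++⁺ʳ (under (_∨ₗ (C [ G ])) (occurrences B)) (∈-under (B ∨ᵣ_) (occurrences-complete C G a∈)))
  occurrences-complete (∀ᶜ x C) G a∈ = strict (∈-under (∀ᶜ x) (occurrences-complete C G a∈))
  occurrences-complete (∃ᶜ x C) G a∈ = strict (∈-under (∃ᶜ x) (occurrences-complete C G a∈))

  AntecedentOccurrence : Set
  AntecedentOccurrence = List Formula × Ctx × A × List Formula

  antecedentOccurrences : List Formula → List AntecedentOccurrence
  antecedentOccurrences [] = []
  antecedentOccurrences (E ∷ Es) =
    map (λ (C , a) → [] , C , a , Es) (occurrences E)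
    ++ map (λ (Gs , occ) → E ∷ Gs , occ) (antecedentOccurrences Es)

  antecedentOccurrences-complete : ∀ Gs C G Ks {a} → a ∈ parts G →
    (Gs , C , a , Ks) ∈ antecedentOccurrences (Gs ++ C [ G ] ∷ Ks)
  antecedentOccurrences-complete [] C G Ks a∈ =
    ∈-++⁺ˡ (∈-map⁺ _ (occurrences-complete C G a∈))
  antecedentOccurrences-complete (E ∷ Gs) C G Ks a∈ =
    ∈-++⁺ʳ _ (∈-map⁺ _ (antecedentOccurrences-complete Gs C G Ks a∈))

⊓-parts ⊔-parts : Formula → List (Formula × Formula)
⊓-parts (H₀ ⊓ H₁) = (H₀ , H₁) ∷ []
⊓-parts _ = []
⊔-parts (H₀ ⊔ H₁) = (H₀ , H₁) ∷ []
⊔-parts _ = []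

⊓x-parts ⊔x-parts : Formula → List (Var × Formula)
⊓x-parts (⊓x x H) = (x , H) ∷ []
⊓x-parts _ = []
⊔x-parts (⊔x x H) = (x , H) ∷ []
⊔x-parts _ = []

data ⊓-Premise (Es : List Formula) : Ctx × Formula × Formula → Set₁ where
  both : ∀ {C H₀ H₁} → CL12⊢ (Es ∘- C [ H₀ ]) → CL12⊢ (Es ∘- C [ H₁ ]) →
    ⊓-Premise Es (C , H₀ , H₁)

data ⊔-Premise (F : Formula) : AntecedentOccurrence ⊔-parts → Set₁ where
  both : ∀ {Gs C H₀ H₁ Ks} →
    CL12⊢ (Gs ++ C [ H₀ ] ∷ Ks ∘- F) → CL12⊢ (Gs ++ C [ H₁ ] ∷ Ks ∘- F) →
    ⊔-Premise F (Gs , C , (H₀ , H₁) , Ks)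

data ⊓x-Premise (Es : List Formula) (F : Formula) : Ctx × Var × Formula → Set₁ where
  fresh : ∀ {C x H} y → {True (y ∉? seqVars (Es ∘- F))} →
    CL12⊢ (Es ∘- C [ substF x (var y) H ]) → ⊓x-Premise Es F (C , x , H)

data ⊔x-Premise (Es : List Formula) (F : Formula) : AntecedentOccurrence ⊔x-parts → Set₁ where
  fresh : ∀ {Gs C x H Ks} y → {True (y ∉? seqVars (Es ∘- F))} →
    CL12⊢ (Gs ++ C [ substF x (var y) H ] ∷ Ks ∘- F) → ⊔x-Premise Es F (Gs , C , (x , H) , Ks)

-- One premise for each surface occurrence of a choice operator, listed in the order of
-- `occurrences`; on concrete sequents the four lists compute.
wait′ : ∀ {Es F} → Es ⊨∥ F →
  All (⊓-Premise Es) (occurrences ⊓-parts F) →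
  All (⊔-Premise F) (antecedentOccurrences ⊔-parts Es) →
  All (⊓x-Premise Es F) (occurrences ⊓x-parts F) →
  All (⊔x-Premise Es F) (antecedentOccurrences ⊔x-parts Es) →
  CL12⊢ (Es ∘- F)
wait′ {Es} {F} st p⊓ p⊔ p⊓x p⊔x = wait Es F (stable-intro Es F st)
  (λ { C H₀ H₁ refl → case⊓ (All.lookup p⊓ (occurrences-complete ⊓-parts C _ (here refl))) })
  (λ { Gs C H₀ H₁ Ks refl →
       case⊔ (All.lookup p⊔ (antecedentOccurrences-complete ⊔-parts Gs C _ Ks (here refl))) })
  (λ { C x H refl → case⊓x (All.lookup p⊓x (occurrences-complete ⊓x-parts C _ (here refl))) })
  (λ { Gs C x H Ks refl →
       case⊔x (All.lookup p⊔x (antecedentOccurrences-complete ⊔x-parts Gs C _ Ks (here refl))) })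
  where
  case⊓ : ∀ {C H₀ H₁} → ⊓-Premise Es (C , H₀ , H₁) → CL12⊢ (Es ∘- C [ H₀ ]) × CL12⊢ (Es ∘- C [ H₁ ])
  case⊓ (both d₀ d₁) = d₀ , d₁
  case⊔ : ∀ {Gs C H₀ H₁ Ks} → ⊔-Premise F (Gs , C , (H₀ , H₁) , Ks) →
    CL12⊢ (Gs ++ C [ H₀ ] ∷ Ks ∘- F) × CL12⊢ (Gs ++ C [ H₁ ] ∷ Ks ∘- F)
  case⊔ (both d₀ d₁) = d₀ , d₁
  case⊓x : ∀ {C x H} → ⊓x-Premise Es F (C , x , H) →
    Σ Var λ y → y ∉ seqVars (Es ∘- F) × CL12⊢ (Es ∘- C [ substF x (var y) H ])
  case⊓x (fresh y {f} d) = y , toWitness f , d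
  case⊔x : ∀ {Gs C x H Ks} → ⊔x-Premise Es F (Gs , C , (x , H) , Ks) →
    Σ Var λ y → y ∉ seqVars (Es ∘- F) × CL12⊢ (Gs ++ C [ substF x (var y) H ] ∷ Ks ∘- F)
  case⊔x (fresh y {f} d) = y , toWitness f , d

admissible? : ∀ t X → Dec (Admissible t X)
admissible? `0 X = yes (inj₁ refl)
admissible? (var v) X with v ∈? seqBound X
... | yes v∈ = no λ { (inj₁ ()) ; (inj₂ (_ , refl , v∉)) → v∉ v∈ }
... | no v∉ = yes (inj₂ (v , refl , v∉))
admissible? (t ′) X = no λ { (inj₁ ()) ; (inj₂ (_ , () , _)) }
admissible? (s `+ t) X = no λ { (inj₁ ()) ; (inj₂ (_ , () , _)) }
admissible? (s `× t) X = no λ { (inj₁ ()) ; (inj₂ (_ , () , _)) }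

-- The context C, given with `_` for its side formulas, determines the rest by unification.
⊔-choose′ : ∀ {Gs} C {H₀ H₁} (i : Bool) →
  CL12⊢ (Gs ∘- C [ pick i H₀ H₁ ]) → CL12⊢ (Gs ∘- C [ H₀ ⊔ H₁ ])
⊔-choose′ {Gs} C i = ⊔-choose Gs C _ _ i

⊔x-choose′ : ∀ {Gs} C {x H} t → {a : True (admissible? t (Gs ∘- C [ substF x t H ]))} →
  CL12⊢ (Gs ∘- C [ substF x t H ]) → CL12⊢ (Gs ∘- C [ ⊔x x H ])
⊔x-choose′ {Gs} C t {a} = ⊔x-choose Gs C _ _ t (toWitness a)

⊓x-choose′ : ∀ Gs C {x H Ks F} t →
  {a : True (admissible? t (Gs ++ C [ substF x t H ] ∷ Ks ∘- F))} →
  CL12⊢ (Gs ++ C [ substF x t H ] ∷ Ks ∘- F) → CL12⊢ (Gs ++ C [ ⊓x x H ] ∷ Ks ∘- F)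
⊓x-choose′ Gs C {Ks = Ks} {F} t {a} = ⊓x-choose Gs C _ _ t Ks F (toWitness a)

infix 5 _≼_
_≼_ : Term → Term → Formula
s ≼ t = `∃ 101 (s `+ var 101 ≐ t)

-- p has no odd factor above 1 (this excludes p = 0 = 0 × 3).
PowerOf2 : Term → Formula
PowerOf2 p = `∀ 101 (`∀ 102 ((p ≐ var 101 `× (var 102 ·1)) ⇒ (var 102 ≐ `0)))

-- |s| ≤ |t| : every power of two up to s is at most t.
SizeLe : Term → Term → Formula
SizeLe s t = `∀ 100 ((var 100 ≼ s `∧ PowerOf2 (var 100)) ⇒ var 100 ≼ t)

-- |z| ≤ |a| + |b| : z + 1 ≤ (u + 1)(v + 1) for some u, v with |u| ≤ |a| and |v| ≤ |b|.
SizeLeSum : Term → Term → Term → Formula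
SizeLeSum z a b =
  `∃ 103 (`∃ 104 (SizeLe (var 103) a `∧ SizeLe (var 104) b `∧ z ≼ var 103 `× var 104 ′ `+ var 104))

InductionAxiom : Formula → Var → Formula
InductionAxiom F v = ∀-closure ((substF v `0 F `∧ `∀ v (F ⇒ substF v (var v ′) F)) ⇒ `∀ v F)

+-assoc-F suc-+-F +-identityˡ-F +-comm-F double-F : Formula
+-assoc-F = (var 10 `+ var 11) `+ var 12 ≐ var 10 `+ (var 11 `+ var 12)
suc-+-F = var 10 ′ `+ var 11 ≐ (var 10 `+ var 11) ′
+-identityˡ-F = `0 `+ var 10 ≐ var 10
+-comm-F = var 10 `+ var 11 ≐ var 11 `+ var 10
double-F = (`0 ′ ′) `× var 10 ≐ var 10 `+ var 10

+-identityʳ-A +-suc-A *-zeroʳ-A *-suc-A : Formula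
+-identityʳ-A = `∀ 0 (var 0 `+ `0 ≐ var 0)
+-suc-A = `∀ 0 (`∀ 1 (var 0 `+ var 1 ′ ≐ (var 0 `+ var 1) ′))
*-zeroʳ-A = `∀ 0 (var 0 `× `0 ≐ `0)
*-suc-A = `∀ 0 (`∀ 1 (var 0 `× var 1 ′ ≐ (var 0 `× var 1) `+ var 0))

Γ-PA : List Formula
Γ-PA = +-identityʳ-A ∷ +-suc-A ∷ *-zeroʳ-A ∷ *-suc-A
     ∷ InductionAxiom +-assoc-F 12 ∷ InductionAxiom suc-+-F 11 ∷ InductionAxiom +-identityˡ-F 10
     ∷ InductionAxiom +-comm-F 11 ∷ InductionAxiom double-F 10 ∷ []

Γ-PA-provable : All CLA4⊢ Γ-PA
Γ-PA-provable = ax-3 ∷ ax-4 ∷ ax-5 ∷ ax-6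
  ∷ ax-ind +-assoc-F 12 _ ∷ ax-ind suc-+-F 11 _ ∷ ax-ind +-identityˡ-F 10 _
  ∷ ax-ind +-comm-F 11 _ ∷ ax-ind double-F 10 _ ∷ []

Γ-PA-sentences : All Sentence Γ-PA
Γ-PA-sentences = refl ∷ refl ∷ refl ∷ refl ∷ refl ∷ refl ∷ refl ∷ refl ∷ refl ∷ []

module Arithmetic (M : Structure) where
  open Structure M
  open Classical M

  infix 4 _≈_
  _≈_ : D → D → Set
  a ≈ b = ¬ ¬ (a ≡ b)

  ≈-setoid : Setoid 0ℓ 0ℓ
  ≈-setoid = record
    { Carrier = D ; _≈_ = _≈_
    ; isEquivalence = record
      { refl = λ k → k refl
      ; sym = λ p k → p (k ∘ sym)
      ; trans = λ p q k → p λ e → q λ e′ → k (trans e e′) } }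

  open Setoid ≈-setoid public using () renaming (refl to ≈-refl; sym to ≈-sym; trans to ≈-trans)
  open ≈-Reasoning ≈-setoid public

  ≈-cong : ∀ (f : D → D) {a b} → a ≈ b → f a ≈ f b
  ≈-cong f p k = p (k ∘ cong f)

  ≈-cong₂ : ∀ (f : D → D → D) {a b c d} → a ≈ b → c ≈ d → f a c ≈ f b d
  ≈-cong₂ f p q k = p λ e → q λ e′ → k (cong₂ f e e′)

  two : D
  two = succ (succ zer)

  record Peano : Set where
    field
      +-identityʳ : ∀ a → add a zer ≈ a
      +-suc : ∀ a b → add a (succ b) ≈ succ (add a b)
      *-zeroʳ : ∀ a → mul a zer ≈ zer
      *-suc : ∀ a b → mul a (succ b) ≈ add (mul a b) a
      +-assoc : ∀ a b c → add (add a b) c ≈ add a (add b c)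
      suc-+ : ∀ a b → add (succ a) b ≈ succ (add a b)
      +-identityˡ : ∀ a → add zer a ≈ a
      +-comm : ∀ a b → add a b ≈ add b a
      double : ∀ a → mul two a ≈ add a a

  induction : ∀ F v ρ → Elementary F →
    ⟦ M ⟧ ((substF v `0 F `∧ `∀ v (F ⇒ substF v (var v ′) F)) ⇒ `∀ v F) ρ →
    ⟦ M ⟧ (substF v `0 F) ρ →
    (∀ d → ⟦ M ⟧ F (update M ρ v d) → ⟦ M ⟧ (substF v (var v ′) F) (update M ρ v d)) →
    ∀ d → ⟦ M ⟧ F (update M ρ v d)
  induction F v ρ e ax base step =
    ⇒-elim (substF v `0 F `∧ `∀ v (F ⇒ substF v (var v ′) F)) (`∀ v F) ρ ax
      (base , λ d → ⇒-intro F (substF v (var v ′) F) (update M ρ v d) e (step d))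

  peano : ∀ ρ → ⟦ M ⟧ (conjElem Γ-PA) ρ → Peano
  peano ρ (+-identityʳ , +-suc , *-zeroʳ , *-suc , ind-assoc , ind-suc-+ , ind-identityˡ , ind-comm , ind-double) =
    record { +-identityʳ = +-identityʳ ; +-suc = +-suc ; *-zeroʳ = *-zeroʳ ; *-suc = *-suc
           ; +-assoc = +-assoc ; suc-+ = suc-+ ; +-identityˡ = +-identityˡ ; +-comm = +-comm ; double = double }
    where
    +-assoc : ∀ a b c → add (add a b) c ≈ add a (add b c)
    +-assoc a b = induction +-assoc-F 12 (update M (update M ρ 10 a) 11 b) _ (ind-assoc a b)
      (begin
        add (add a b) zer  ≈⟨ +-identityʳ _ ⟩
        add a b            ≈⟨ ≈-cong (add a) (+-identityʳ b) ⟨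
        add a (add b zer)  ∎)
      λ c ih → begin
        add (add a b) (succ c)  ≈⟨ +-suc _ _ ⟩
        succ (add (add a b) c)  ≈⟨ ≈-cong succ ih ⟩
        succ (add a (add b c))  ≈⟨ +-suc a _ ⟨
        add a (succ (add b c))  ≈⟨ ≈-cong (add a) (+-suc b c) ⟨
        add a (add b (succ c))  ∎
    suc-+ : ∀ a b → add (succ a) b ≈ succ (add a b)
    suc-+ a = induction suc-+-F 11 (update M ρ 10 a) _ (ind-suc-+ a)
      (begin
        add (succ a) zer  ≈⟨ +-identityʳ _ ⟩
        succ a            ≈⟨ ≈-cong succ (+-identityʳ a) ⟨
        succ (add a zer)  ∎)
      λ c ih → begin
        add (succ a) (succ c)  ≈⟨ +-suc _ _ ⟩
        succ (add (succ a) c)  ≈⟨ ≈-cong succ ih ⟩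
        succ (succ (add a c))  ≈⟨ ≈-cong succ (+-suc a c) ⟨
        succ (add a (succ c))  ∎
    +-identityˡ : ∀ a → add zer a ≈ a
    +-identityˡ = induction +-identityˡ-F 10 ρ _ ind-identityˡ (+-identityʳ zer)
      λ c ih → begin
        add zer (succ c)  ≈⟨ +-suc _ _ ⟩
        succ (add zer c)  ≈⟨ ≈-cong succ ih ⟩
        succ c            ∎
    +-comm : ∀ a b → add a b ≈ add b a
    +-comm a = induction +-comm-F 11 (update M ρ 10 a) _ (ind-comm a)
      (begin
        add a zer  ≈⟨ +-identityʳ a ⟩
        a          ≈⟨ +-identityˡ a ⟨
        add zer a  ∎)
      λ c ih → begin
        add a (succ c)  ≈⟨ +-suc _ _ ⟩
        succ (add a c)  ≈⟨ ≈-cong succ ih ⟩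
        succ (add c a)  ≈⟨ suc-+ c a ⟨
        add (succ c) a  ∎
    double : ∀ a → mul two a ≈ add a a
    double = induction double-F 10 ρ _ ind-double
      (begin
        mul two zer  ≈⟨ *-zeroʳ _ ⟩
        zer          ≈⟨ +-identityʳ zer ⟨
        add zer zer  ∎)
      λ c ih → begin
        mul two (succ c)                ≈⟨ *-suc _ _ ⟩
        add (mul two c) two             ≈⟨ ≈-cong (λ w → add w two) ih ⟩
        add (add c c) two               ≈⟨ +-suc _ _ ⟩
        succ (add (add c c) (succ zer)) ≈⟨ ≈-cong succ (+-suc _ _) ⟩
        succ (succ (add (add c c) zer)) ≈⟨ ≈-cong (succ ∘ succ) (+-identityʳ _) ⟩
        succ (succ (add c c))           ≈⟨ ≈-cong succ (+-suc c c) ⟨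
        succ (add c (succ c))           ≈⟨ suc-+ c (succ c) ⟨
        add (succ c) (succ c)           ∎

  Γ-PA-split : ∀ ρ E Es → ⟦ M ⟧ (conjElem (Γ-PA ++ E ∷ Es)) ρ → Peano × ⟦ M ⟧ (conjElem (E ∷ Es)) ρ
  Γ-PA-split ρ E Es (h₁ , h₂ , h₃ , h₄ , h₅ , h₆ , h₇ , h₈ , h₉ , rest) =
    peano ρ (h₁ , h₂ , h₃ , h₄ , h₅ , h₆ , h₇ , h₈ , h₉) , rest

  -- Semantics of the size formulas, read off in a canonical environment; at any other environment
  -- with the same values of the free variables they agree definitionally.
  ⟨_,_,_⟩ : D → D → D → Var → D
  ⟨ a , b , c ⟩ 0 = a
  ⟨ a , b , c ⟩ 1 = b
  ⟨ a , b , c ⟩ _ = c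

  infix 4 _≼ᴹ_
  _≼ᴹ_ : D → D → Set
  a ≼ᴹ b = ⟦ M ⟧ (var 0 ≼ var 1) ⟨ a , b , b ⟩

  SizeLeᴹ : D → D → Set
  SizeLeᴹ a b = ⟦ M ⟧ (SizeLe (var 0) (var 1)) ⟨ a , b , b ⟩

  SizeLeSumᴹ : D → D → D → Set
  SizeLeSumᴹ z a b = ⟦ M ⟧ (SizeLeSum (var 0) (var 1) (var 2)) ⟨ z , a , b ⟩

  module PeanoProperties (pa : Peano) where
    open Peano pa

    +-interchange : ∀ a b c d → add (add a b) (add c d) ≈ add (add a c) (add b d)
    +-interchange a b c d = begin
      add (add a b) (add c d)  ≈⟨ +-assoc _ _ _ ⟩
      add a (add b (add c d))  ≈⟨ ≈-cong (add a) (+-assoc _ _ _) ⟨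
      add a (add (add b c) d)  ≈⟨ ≈-cong (λ w → add a (add w d)) (+-comm b c) ⟩
      add a (add (add c b) d)  ≈⟨ ≈-cong (add a) (+-assoc _ _ _) ⟩
      add a (add c (add b d))  ≈⟨ +-assoc _ _ _ ⟨
      add (add a c) (add b d)  ∎

    double-+ : ∀ a b → mul two (add a b) ≈ add (mul two a) (mul two b)
    double-+ a b = begin
      mul two (add a b)               ≈⟨ double _ ⟩
      add (add a b) (add a b)         ≈⟨ +-interchange _ _ _ _ ⟩
      add (add a a) (add b b)         ≈⟨ ≈-cong₂ add (double a) (double b) ⟨
      add (mul two a) (mul two b)     ∎

    double-suc : ∀ a → mul two (succ a) ≈ succ (succ (mul two a))
    double-suc a = begin
      mul two (succ a)                  ≈⟨ *-suc _ _ ⟩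
      add (mul two a) two               ≈⟨ +-suc _ _ ⟩
      succ (add (mul two a) (succ zer)) ≈⟨ ≈-cong succ (+-suc _ _) ⟩
      succ (succ (add (mul two a) zer)) ≈⟨ ≈-cong (succ ∘ succ) (+-identityʳ _) ⟩
      succ (succ (mul two a))           ∎

    ≼-intro : ∀ a b d → add a d ≈ b → a ≼ᴹ b
    ≼-intro a b d e f = f d e

    ≼-refl : ∀ a → a ≼ᴹ a
    ≼-refl a = ≼-intro a a zer (+-identityʳ a)

    ≼-trans : ∀ {a b c} → a ≼ᴹ b → b ≼ᴹ c → a ≼ᴹ c
    ≼-trans {a} {b} {c} p q f = p λ d e → q λ d′ e′ → f (add d d′) (begin
      add a (add d d′)  ≈⟨ +-assoc _ _ _ ⟨
      add (add a d) d′  ≈⟨ ≈-cong (λ w → add w d′) e ⟩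
      add b d′          ≈⟨ e′ ⟩
      c                 ∎)

    ≼-resp : ∀ {a a′ b b′} → a ≈ a′ → b ≈ b′ → a ≼ᴹ b → a′ ≼ᴹ b′
    ≼-resp ea eb p f = p λ d e → f d (≈-trans (≈-cong (λ w → add w d) (≈-sym ea)) (≈-trans e eb))

    ≼-+ : ∀ a b → a ≼ᴹ add a b
    ≼-+ a b = ≼-intro a _ b ≈-refl

    ≼-suc : ∀ {a b} → a ≼ᴹ b → succ a ≼ᴹ succ b
    ≼-suc {a} {b} p f = p λ d e → f d (≈-trans (suc-+ a d) (≈-cong succ e))

    ≼-+-mono : ∀ {a a′ b b′} → a ≼ᴹ a′ → b ≼ᴹ b′ → add a b ≼ᴹ add a′ b′
    ≼-+-mono {a} {a′} {b} {b′} p q f = p λ d e → q λ d′ e′ →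
      f (add d d′) (≈-trans (+-interchange a b d d′) (≈-cong₂ add e e′))

    ≼-*-suc : ∀ a b → a ≼ᴹ mul a (succ b)
    ≼-*-suc a b = ≼-intro a _ (mul a b) (≈-trans (+-comm _ _) (≈-sym (*-suc a b)))

    ≼-double : ∀ a → a ≼ᴹ mul two a
    ≼-double a = ≼-intro _ _ a (≈-sym (double a))

    ≼-double+1 : ∀ a → a ≼ᴹ succ (mul two a)
    ≼-double+1 a = ≼-intro _ _ (succ a) (≈-trans (+-suc _ _) (≈-cong succ (≈-sym (double a))))

    double⇒≼ : ∀ {h x} → x ≈ mul two h → h ≼ᴹ x
    double⇒≼ x≈2h = ≼-resp ≈-refl (≈-sym x≈2h) (≼-double _)

    double+1⇒≼ : ∀ {h x} → x ≈ succ (mul two h) → h ≼ᴹ x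
    double+1⇒≼ x≈2h+1 = ≼-resp ≈-refl (≈-sym x≈2h+1) (≼-double+1 _)

    SizeLe-refl : ∀ a → SizeLeᴹ a a
    SizeLe-refl a p = ⇒-introᵈ M (var 100 ≼ var 0 `∧ PowerOf2 (var 100)) (var 100 ≼ var 1)
      (update M ⟨ a , a , a ⟩ 100 p) proj₁

    SizeLe-monoʳ : ∀ {a b b′} → b ≼ᴹ b′ → SizeLeᴹ a b → SizeLeᴹ a b′
    SizeLe-monoʳ {a} {b} {b′} b≼b′ s p =
      ⇒-introᵈ M (var 100 ≼ var 0 `∧ PowerOf2 (var 100)) (var 100 ≼ var 1) (update M ⟨ a , b′ , b′ ⟩ 100 p)
        λ h → ≼-trans (⇒-elim (var 100 ≼ var 0 `∧ PowerOf2 (var 100)) (var 100 ≼ var 1)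
                         (update M ⟨ a , b , b ⟩ 100 p) (s p) h) b≼b′

    SizeLeSum-intro : ∀ {z a b} u v → SizeLeᴹ u a → SizeLeᴹ v b → z ≼ᴹ add (mul u (succ v)) v →
      SizeLeSumᴹ z a b
    SizeLeSum-intro u v su sv z≼ f = f u λ g → g v (su , sv , z≼)

    SizeLeSum-antimono : ∀ {z z′ a b} → z′ ≼ᴹ z → SizeLeSumᴹ z a b → SizeLeSumᴹ z′ a b
    SizeLeSum-antimono z′≼z s f = s λ u k → k λ v (su , sv , z≼) → f u λ g → g v (su , sv , ≼-trans z′≼z z≼)

    SizeLeSum-resp : ∀ {z z′ a b} → z ≈ z′ → SizeLeSumᴹ z a b → SizeLeSumᴹ z′ a b
    SizeLeSum-resp e = SizeLeSum-antimono (≼-intro _ _ zer (≈-trans (+-identityʳ _) (≈-sym e)))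

    summands-small : ∀ a b → SizeLeSumᴹ a a b × SizeLeSumᴹ (add a b) a b
    summands-small a b =
      SizeLeSum-intro a b (SizeLe-refl a) (SizeLe-refl b) (≼-trans (≼-*-suc a b) (≼-+ _ b)) ,
      SizeLeSum-intro a b (SizeLe-refl a) (SizeLe-refl b) (≼-+-mono (≼-*-suc a b) (≼-refl b))

module StandardModel where
  open import Data.Nat.Base using (_≤_; _<_; _^_; _*_; _+_; _∸_; z≤n; s≤s; ⌊_/2⌋; ⌈_/2⌉)
  open import Data.Nat.Properties
  open import Data.Nat.Logarithm using (⌈log₂_⌉; ⌈log₂⌉-mono-≤; ⌈log₂2^n⌉≡n; ⌈log₂⌈n/2⌉⌉≡⌈log₂n⌉∸1)
  open import Data.Nat.Induction using (<-rec)
  open import Data.Nat.Tactic.RingSolver using (solve-∀)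
  open import Data.Sum using (_⊎_)
  open import Relation.Nullary using (contradiction)
  open import Relation.Nullary.Decidable using (decidable-stable)
  open import Relation.Binary.PropositionalEquality using (subst)
  open Arithmetic ℕ-Model using (_≼ᴹ_; SizeLeᴹ; SizeLeSumᴹ; ⟨_,_,_⟩)

  ≤2^⇒⌈log₂⌉≤ : ∀ {m} k → m ≤ 2 ^ k → ⌈log₂ m ⌉ ≤ k
  ≤2^⇒⌈log₂⌉≤ {m} k m≤ = subst (⌈log₂ m ⌉ ≤_) (⌈log₂2^n⌉≡n k) (⌈log₂⌉-mono-≤ m≤)

  ⌈log₂⌉≤⇒≤2^ : ∀ {m} k → ⌈log₂ m ⌉ ≤ k → m ≤ 2 ^ k
  ⌈log₂⌉≤⇒≤2^ {m} zero h with m ≤? 1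
  ... | yes m≤1 = m≤1
  ... | no m≰1 = contradiction (≤-trans ⌈log₂2⌉≤⌈log₂m⌉ h) λ ()
    where
    ⌈log₂2⌉≤⌈log₂m⌉ : 1 ≤ ⌈log₂ m ⌉
    ⌈log₂2⌉≤⌈log₂m⌉ = subst (_≤ ⌈log₂ m ⌉) (⌈log₂2^n⌉≡n 1) (⌈log₂⌉-mono-≤ (≰⇒> m≰1))
  ⌈log₂⌉≤⇒≤2^ {m} (suc k) h = begin
      m                    ≡⟨ ⌊n/2⌋+⌈n/2⌉≡n m ⟨
      ⌊ m /2⌋ + ⌈ m /2⌉    ≤⟨ +-monoˡ-≤ _ (⌊n/2⌋≤⌈n/2⌉ m) ⟩
      ⌈ m /2⌉ + ⌈ m /2⌉    ≤⟨ +-mono-≤ half≤ (≤-trans half≤ (≤-reflexive (sym (+-identityʳ _)))) ⟩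
      2 ^ suc k            ∎
    where
    open ≤-Reasoning
    half≤ : ⌈ m /2⌉ ≤ 2 ^ k
    half≤ = ⌈log₂⌉≤⇒≤2^ k (subst (_≤ k) (sym (⌈log₂⌈n/2⌉⌉≡⌈log₂n⌉∸1 m)) (∸-monoˡ-≤ 1 h))

  ∣n∣≤k⇒n<2^k : ∀ n k → ∣ n ∣ ≤ k → n < 2 ^ k
  ∣n∣≤k⇒n<2^k n = ⌈log₂⌉≤⇒≤2^

  n<2^k⇒∣n∣≤k : ∀ n k → n < 2 ^ k → ∣ n ∣ ≤ k
  n<2^k⇒∣n∣≤k n = ≤2^⇒⌈log₂⌉≤

  OddFactorFree : ℕ → Set
  OddFactorFree p = ∀ d e → p ≡ d * suc (2 * e) → e ≡ 0

  parity : ∀ n → Σ ℕ λ q → n ≡ 2 * q ⊎ n ≡ suc (2 * q)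
  parity zero = 0 , inj₁ refl
  parity (suc n) with parity n
  ... | q , inj₁ refl = q , inj₂ refl
  ... | q , inj₂ refl = suc q , inj₁ (cong suc (sym (+-suc q (q + 0))))

  2^-oddFactorFree : ∀ k → OddFactorFree (2 ^ k)
  2^-oddFactorFree zero (suc d) e eq = m+n≡0⇒m≡0 e (m+n≡0⇒m≡0 (2 * e) (suc-injective (sym eq)))
  2^-oddFactorFree (suc k) d e eq with parity d
  ... | q , inj₁ refl =
    2^-oddFactorFree k q e (*-cancelˡ-≡ (2 ^ k) (q * suc (2 * e)) 2 (trans eq (*-assoc 2 q _)))
  ... | q , inj₂ refl = contradiction (trans eq (odd*odd q e)) (even≢odd (2 ^ k) (e + q * suc (2 * e)))
    where
    odd*odd : ∀ q e → suc (2 * q) * suc (2 * e) ≡ suc (2 * (e + q * suc (2 * e)))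
    odd*odd = solve-∀

  oddFactorFree⇒2^ : ∀ p → 0 < p → OddFactorFree p → Σ ℕ λ k → p ≡ 2 ^ k
  oddFactorFree⇒2^ = <-rec _ step
    where
    step : ∀ p → (∀ {q} → q < p → 0 < q → OddFactorFree q → Σ ℕ λ k → q ≡ 2 ^ k) →
      0 < p → OddFactorFree p → Σ ℕ λ k → p ≡ 2 ^ k
    step p rec p>0 free with parity p
    ... | q , inj₂ refl with free 1 q (sym (*-identityˡ _))
    ...   | refl = 0 , refl
    step p rec () free | zero , inj₁ refl
    step p rec p>0 free | suc q , inj₁ refl =
      let k , eq = rec (m<m+n (suc q) (s≤s z≤n)) (s≤s z≤n) halfFree in suc k , cong (2 *_) eq
      where
      halfFree : OddFactorFree (suc q)
      halfFree d e eq = free (2 * d) e (trans (cong (2 *_) eq) (sym (*-assoc 2 d _)))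

  ≼ᴹ⇒≤ : ∀ {x y} → x ≼ᴹ y → x ≤ y
  ≼ᴹ⇒≤ {x} {y} h = decidable-stable (x ≤? y) λ x≰y →
    h λ d e → e λ eq → x≰y (subst (x ≤_) eq (m≤m+n x d))

  ≤⇒≼ᴹ : ∀ {x y} → x ≤ y → x ≼ᴹ y
  ≤⇒≼ᴹ {x} {y} x≤y f = f (y ∸ x) λ k → k (m+[n∸m]≡n x≤y)

  PowerOf2ᴹ : ℕ → Set
  PowerOf2ᴹ p = ⟦ ℕ-Model ⟧ (PowerOf2 (var 0)) ⟨ p , p , p ⟩

  PowerOf2ᴹ⇒oddFactorFree : ∀ {p} → PowerOf2ᴹ p → OddFactorFree p
  PowerOf2ᴹ⇒oddFactorFree h d e eq = decidable-stable (e ≟ 0) λ e≢0 → h d e ((λ k → k eq) , (λ k → k e≢0))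

  oddFactorFree⇒PowerOf2ᴹ : ∀ {p} → OddFactorFree p → PowerOf2ᴹ p
  oddFactorFree⇒PowerOf2ᴹ free d e (p≢ , e≢0) = p≢ λ eq → e≢0 λ k → k (free d e eq)

  private
    powerOf2≼ : Formula
    powerOf2≼ = var 100 ≼ var 0 `∧ PowerOf2 (var 100)

  -- If |x| > |y| then 2^|y| is a power of two up to x but above y.
  SizeLe-sound : ∀ {x y} → SizeLeᴹ x y → ∣ x ∣ ≤ ∣ y ∣
  SizeLe-sound {x} {y} h = decidable-stable (∣ x ∣ ≤? ∣ y ∣) λ ∣x∣≰∣y∣ →
    let k = ∣ y ∣
        2^k≤x : 2 ^ k ≤ x
        2^k≤x = decidable-stable (2 ^ k ≤? x) λ 2^k≰x → ∣x∣≰∣y∣ (n<2^k⇒∣n∣≤k x k (≰⇒> 2^k≰x))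
        2^k≤y : 2 ^ k ≤ y
        2^k≤y = ≼ᴹ⇒≤ (Classical.⇒-elim ℕ-Model powerOf2≼ (var 100 ≼ var 1)
                        (update ℕ-Model ⟨ x , y , y ⟩ 100 (2 ^ k)) (h (2 ^ k))
                        (≤⇒≼ᴹ 2^k≤x , oddFactorFree⇒PowerOf2ᴹ (2^-oddFactorFree k)))
    in <⇒≱ (∣n∣≤k⇒n<2^k y k ≤-refl) 2^k≤y

  SizeLe-complete : ∀ {x y} → ∣ x ∣ ≤ ∣ y ∣ → SizeLeᴹ x y
  SizeLe-complete {x} {y} ∣x∣≤∣y∣ p =
    ⇒-introᵈ ℕ-Model powerOf2≼ (var 100 ≼ var 1) (update ℕ-Model ⟨ x , y , y ⟩ 100 p)
      λ (p≼x , pow) → ≤⇒≼ᴹ (bound p (≼ᴹ⇒≤ p≼x) (PowerOf2ᴹ⇒oddFactorFree pow))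
    where
    bound : ∀ p → p ≤ x → OddFactorFree p → p ≤ y
    bound zero _ _ = z≤n
    bound (suc p) p≤x free with oddFactorFree⇒2^ (suc p) (s≤s z≤n) free
    ... | j , eq = decidable-stable (suc p ≤? y) λ p≰y →
      let x<2^j : x < 2 ^ j
          x<2^j = begin-strict
            x          <⟨ ∣n∣≤k⇒n<2^k x _ ≤-refl ⟩
            2 ^ ∣ x ∣  ≤⟨ ^-monoʳ-≤ 2 ∣x∣≤∣y∣ ⟩
            2 ^ ∣ y ∣  ≤⟨ ^-monoʳ-≤ 2 (n<2^k⇒∣n∣≤k y j (subst (y <_) eq (≰⇒> p≰y))) ⟩
            2 ^ j      ∎
      in <⇒≱ x<2^j (subst (_≤ x) eq p≤x)
      where open ≤-Reasoning

  2^≡suc : ∀ k → Σ ℕ λ u → 2 ^ k ≡ suc u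
  2^≡suc k with 2 ^ k | m^n>0 2 k
  ... | suc u | _ = u , refl

  private
    suc*suc : ∀ u v → suc u * suc v ≡ suc (u * suc v + v)
    suc*suc = solve-∀

  SizeLeSum-sound : ∀ {z a b} → SizeLeSumᴹ z a b → ∣ z ∣ ≤ ∣ a ∣ + ∣ b ∣
  SizeLeSum-sound {z} {a} {b} h = decidable-stable (∣ z ∣ ≤? ∣ a ∣ + ∣ b ∣) λ ∣z∣≰ →
    h λ u k → k λ v (su , sv , z≼) → ∣z∣≰ (n<2^k⇒∣n∣≤k z (∣ a ∣ + ∣ b ∣) (begin-strict
      z                      ≤⟨ ≼ᴹ⇒≤ z≼ ⟩
      u * suc v + v          <⟨ n<1+n _ ⟩
      suc (u * suc v + v)    ≡⟨ suc*suc u v ⟨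
      suc u * suc v          ≤⟨ *-mono-≤ (∣n∣≤k⇒n<2^k u _ (SizeLe-sound su)) (∣n∣≤k⇒n<2^k v _ (SizeLe-sound sv)) ⟩
      2 ^ ∣ a ∣ * 2 ^ ∣ b ∣  ≡⟨ ^-distribˡ-+-* 2 ∣ a ∣ ∣ b ∣ ⟨
      2 ^ (∣ a ∣ + ∣ b ∣)    ∎))
    where open ≤-Reasoning

  SizeLeSum-complete : ∀ {z a b} → ∣ z ∣ ≤ ∣ a ∣ + ∣ b ∣ → SizeLeSumᴹ z a b
  SizeLeSum-complete {z} {a} {b} ∣z∣≤ f with 2^≡suc ∣ a ∣ | 2^≡suc ∣ b ∣
  ... | u , 2^∣a∣≡ | v , 2^∣b∣≡ = f u λ g → g v
    ( SizeLe-complete (n<2^k⇒∣n∣≤k u ∣ a ∣ (≤-reflexive (sym 2^∣a∣≡)))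
    , SizeLe-complete (n<2^k⇒∣n∣≤k v ∣ b ∣ (≤-reflexive (sym 2^∣b∣≡)))
    , ≤⇒≼ᴹ (≤-pred (begin
        suc z                  ≤⟨ ∣n∣≤k⇒n<2^k z _ ∣z∣≤ ⟩
        2 ^ (∣ a ∣ + ∣ b ∣)    ≡⟨ ^-distribˡ-+-* 2 ∣ a ∣ ∣ b ∣ ⟩
        2 ^ ∣ a ∣ * 2 ^ ∣ b ∣  ≡⟨ cong₂ _*_ 2^∣a∣≡ 2^∣b∣≡ ⟩
        suc u * suc v          ≡⟨ suc*suc u v ⟩
        suc (u * suc v + v)    ∎)) )
    where open ≤-Reasoning

  SizeLe-meaning : ∀ {x y} → SizeLeᴹ x y ⇔ (∣ x ∣ ≤ ∣ y ∣)
  SizeLe-meaning = mk⇔ SizeLe-sound SizeLe-complete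

  SizeLeSum-meaning : ∀ {z a b} → SizeLeSumᴹ z a b ⇔ (∣ z ∣ ≤ ∣ a ∣ + ∣ b ∣)
  SizeLeSum-meaning = mk⇔ SizeLeSum-sound SizeLeSum-complete

elementary⇒polyBounded : ∀ F → Elementary F → PolyBounded F
elementary⇒polyBounded `⊤ e = tt
elementary⇒polyBounded `⊥ e = tt
elementary⇒polyBounded (a ≐ b) e = tt
elementary⇒polyBounded (a ≠ b) e = tt
elementary⇒polyBounded (A `∧ B) (eA , eB) = elementary⇒polyBounded A eA , elementary⇒polyBounded B eB
elementary⇒polyBounded (A `∨ B) (eA , eB) = elementary⇒polyBounded A eA , elementary⇒polyBounded B eB
elementary⇒polyBounded (`∀ x A) e = elementary⇒polyBounded A e
elementary⇒polyBounded (`∃ x A) e = elementary⇒polyBounded A e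

sizeBound : ∀ x S τ → {True (elementary? S)} → {True (x ∉? varsT τ)} →
  {True (all? (_∈? (x ∷ varsT τ)) (fv S))} →
  (∀ ρ → ⟦ ℕ-Model ⟧ S ρ ⇔ (∣ ρ x ∣ ≤ evalT ℕ-Model (λ v → ∣ ρ v ∣) τ)) → SizeBound x S
sizeBound x S τ {e} {x∉} {fv⊆} meaning = toWitness e , τ , toWitness x∉ , toWitness fv⊆ , meaning

_·[_] : Term → Bool → Term
t ·[ false ] = t ·0
t ·[ true ] = t ·1

-- x = var 20 is halved by h = var 21
Halve : Formula
Halve = ⊔x 21 (SizeLe (var 21) (var 20) `∧ ((var 20 ≐ var 21 ·0) ⊔ (var 20 ≐ var 21 ·1)))

Halve-polyBounded : PolyBounded Halve
Halve-polyBounded =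
  (elementary⇒polyBounded (SizeLe (var 21) (var 20)) _ , tt , tt) , _ , _ , refl ,
  sizeBound 21 (SizeLe (var 21) (var 20)) (var 20)
    λ _ → StandardModel.SizeLe-meaning

halving-base : CL12⊢ (Γ-PA ∘- ⊓-closure (substF 20 `0 Halve))
halving-base = ⊔x-choose′ ∙ `0 (⊔-choose′ (_ ∧ᵣ ∙) false (wait′ zero-halves [] [] [] []))
  where
  zero-halves : Γ-PA ⊨∥ SizeLe `0 `0 `∧ (`0 ≐ `0 ·0)
  zero-halves .⊨∥-elim M ρ h = SizeLe-refl _ , ≈-sym (*-zeroʳ _)
    where open Arithmetic M; open Peano (peano ρ h); open PeanoProperties (peano ρ h)

x-halves-x·[_] : ∀ i {G} → Γ-PA ⊨∥ G `∨ (SizeLe (var 200) (var 200 ·[ i ]) `∧ (var 200 ·[ i ] ≐ var 200 ·[ i ]))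
x-halves-x·[ false ] .⊨∥-elim M ρ h = ∨-introʳ (SizeLe-monoʳ (≼-double _) (SizeLe-refl _) , ≈-refl)
  where open Arithmetic M; open PeanoProperties (peano ρ h)
x-halves-x·[ true ] .⊨∥-elim M ρ h = ∨-introʳ (SizeLe-monoʳ (≼-double+1 _) (SizeLe-refl _) , ≈-refl)
  where open Arithmetic M; open PeanoProperties (peano ρ h)

-- 2x + i is halved by x.
halving-step : ∀ i → CL12⊢ (Γ-PA ∘- ⊓-closure (Halve ⇒ substF 20 (var 20 ·[ i ]) Halve))
halving-step false =
  wait′ (⊨∥-intro λ _ _ _ → tt) [] []
  (fresh 200 (⊔x-choose′ (_ ∨ᵣ ∙) (var 200) (⊔-choose′ (_ ∨ᵣ (_ ∧ᵣ ∙)) false (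
    wait′ (⊨∥-intro λ _ _ _ → ∨-introˡ tt) [] []
    (fresh 201 (
      wait′ (⊨∥-intro λ _ _ _ → ∨-introˡ (∨-introʳ tt))
        (both (wait′ x-halves-x·[ false ] [] [] [] []) (wait′ x-halves-x·[ false ] [] [] [] []) ∷ []) [] [] []
    ) ∷ []) []))) ∷ []) []
halving-step true =
  wait′ (⊨∥-intro λ _ _ _ → tt) [] []
  (fresh 200 (⊔x-choose′ (_ ∨ᵣ ∙) (var 200) (⊔-choose′ (_ ∨ᵣ (_ ∧ᵣ ∙)) true (
    wait′ (⊨∥-intro λ _ _ _ → ∨-introˡ tt) [] []
    (fresh 201 (
      wait′ (⊨∥-intro λ _ _ _ → ∨-introˡ (∨-introʳ tt))
        (both (wait′ x-halves-x·[ true ] [] [] [] []) (wait′ x-halves-x·[ true ] [] [] [] []) ∷ []) [] [] []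
    ) ∷ []) []))) ∷ []) []

halving : CLA4⊢ (⊓-closure Halve)
halving = cla4-induction Halve 20 Halve-polyBounded
  (logical-consequence Γ-PA _ Γ-PA-provable Γ-PA-sentences refl halving-base)
  (logical-consequence Γ-PA _ Γ-PA-provable Γ-PA-sentences refl (halving-step false))
  (logical-consequence Γ-PA _ Γ-PA-provable Γ-PA-sentences refl (halving-step true))

-- The sum z = var 31 of x = var 30 and y, given that |x|, |x + y| ≤ |a| + |b|.
BoundedAddition : Term → Term → Term → Formula
BoundedAddition a b y = ⊓x 30 (SizeLeSum (var 30) a b ⇒ (SizeLeSum (var 30 `+ y) a b ⇒
  ⊔x 31 (SizeLeSum (var 31) a b `∧ (var 31 ≐ var 30 `+ y))))

Addition : Formula
Addition = BoundedAddition (var 32) (var 33) (var 34)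

Addition-polyBounded : PolyBounded Addition
Addition-polyBounded =
  ( ( elementary⇒polyBounded (`¬ (SizeLeSum (var 30) (var 32) (var 33))) _
    , elementary⇒polyBounded (`¬ (SizeLeSum (var 30 `+ var 34) (var 32) (var 33))) _
    , (elementary⇒polyBounded (SizeLeSum (var 31) (var 32) (var 33)) _ , tt)
    , _ , _ , refl , sizeBound 31 (SizeLeSum (var 31) (var 32) (var 33)) (var 32 `+ var 33)
        λ _ → StandardModel.SizeLeSum-meaning)
  , _ , _ , refl , sizeBound 30 (SizeLeSum (var 30) (var 32) (var 33)) (var 32 `+ var 33)
        λ _ → StandardModel.SizeLeSum-meaning)

-- In the induction step a = var 200, b = var 201, y = var 202 and x = var 203.
Small : Term → Formula
Small t = SizeLeSum t (var 200) (var 201)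

IH-at : Term → Formula
IH-at U = Small U `∧ (Small (U `+ var 202) `∧ ⊓x 31 (Small (var 31) ⇒ (var 31 ≠ U `+ var 202)))

IH-answer : Term → Var → Formula
IH-answer U z = Small U `∧ (Small (U `+ var 202) `∧ (Small (var z) ⇒ (var z ≠ U `+ var 202)))

Goal : Term → Formula
Goal T = Small (var 203) ⇒ (Small (var 203 `+ T) ⇒ ⊔x 31 (Small (var 31) `∧ (var 31 ≐ var 203 `+ T)))

Goal-by : Var → Term → Formula
Goal-by w T = Small (var 203) ⇒ (Small (var 203 `+ T) ⇒ (Small (var w) `∧ (var w ≐ var 203 `+ T)))

-- The IH is invoked at u = var 300 ≤ x for the summand y ≤ t = var 301, and its answer z = var 302
-- yields the final answer w = var 303.  Stated for these fixed variables, so that evaluation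
-- computes, the two lemmas match every case of the step definitionally.
module _ (M : Structure) (ρ : Var → Structure.D M) where
  open Structure M
  open Arithmetic M

  stepEnv : (u t z w : D) → Var → D
  stepEnv u t z w = update M (update M (update M (update M ρ 300 u) 301 t) 302 z) 303 w

  IH-applies : Peano → ∀ {u t} → u ≼ᴹ ρ 203 → ρ 202 ≼ᴹ t →
    ⟦ M ⟧ ∥ IH-at (var 300) `∨ Goal (var 301) ∥ (stepEnv u t zer zer)
  IH-applies pa {u} {t} u≼x y≼t =
    ∨⇒⇒-intro M (stepEnv u t zer zer) ∥ IH-at (var 300) ∥ (Small (var 203)) (Small (var 203 `+ var 301)) `⊥
      λ x-small x+t-small _ →
        SizeLeSum-antimono u≼x x-small , SizeLeSum-antimono (≼-+-mono u≼x y≼t) x+t-small , tt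
    where open PeanoProperties pa

  IH-answers : Peano → ∀ {u t z w} → u ≼ᴹ ρ 203 → ρ 202 ≼ᴹ t → (z ≈ add u (ρ 202) → w ≈ add (ρ 203) t) →
    ⟦ M ⟧ (IH-answer (var 300) 302 `∨ Goal-by 303 (var 301)) (stepEnv u t z w)
  IH-answers pa {u} {t} {z} {w} u≼x y≼t answer =
    ∨⇒⇒-intro M (stepEnv u t z w) (IH-answer (var 300) 302) (Small (var 203)) (Small (var 203 `+ var 301))
      (Small (var 303) `∧ (var 303 ≐ var 203 `+ var 301))
      λ x-small x+t-small ¬goal →
        SizeLeSum-antimono u≼x x-small , SizeLeSum-antimono (≼-+-mono u≼x y≼t) x+t-small ,
        ⇒-introᵈ M (Small (var 302)) (var 302 ≠ var 300 `+ var 202) (stepEnv u t z w) λ _ z≡u+y →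
          let w≈x+t = answer λ k → k z≡u+y
          in ¬goal (SizeLeSum-resp (≈-sym w≈x+t) x+t-small , w≈x+t)
    where open PeanoProperties pa

by-Peano : ∀ {E Es F} →
  (∀ M ρ → Arithmetic.Peano M → ⟦ M ⟧ (conjElem (E ∷ Es)) ρ → ⟦ M ⟧ ∥ F ∥ ρ) → Γ-PA ++ E ∷ Es ⊨∥ F
by-Peano {E} {Es} f .⊨∥-elim M ρ h = let pa , rest = Arithmetic.Γ-PA-split M ρ E Es h in f M ρ pa rest

addition-base : CL12⊢ (Γ-PA ∘- ⊓-closure (substF 34 `0 Addition))
addition-base =
  wait′ (⊨∥-intro λ _ _ _ → tt) [] [] (fresh 200 (
  wait′ (⊨∥-intro λ _ _ _ → tt) [] [] (fresh 201 (
  wait′ (⊨∥-intro λ _ _ _ → tt) [] [] (fresh 202 (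
  ⊔x-choose′ (_ ∨ᵣ (_ ∨ᵣ ∙)) (var 202) (wait′ x+0≡x [] [] [] [])) ∷ []) []) ∷ []) []) ∷ []) []
  where
  x+0≡x : Γ-PA ⊨∥ Small (var 202) ⇒ (Small (var 202 `+ `0) ⇒ (Small (var 202) `∧ (var 202 ≐ var 202 `+ `0)))
  x+0≡x .⊨∥-elim M ρ h =
    ⇒-introᵈ M (Small x) (Small (x `+ `0) ⇒ (Small x `∧ (x ≐ x `+ `0))) ρ λ x-small →
    ⇒-introᵈ M (Small (x `+ `0)) (Small x `∧ (x ≐ x `+ `0)) ρ λ _ →
      x-small , ≈-sym (Peano.+-identityʳ (peano ρ h) _)
    where
    open Arithmetic M
    x : Term
    x = var 202

doubling-A successor-A : Formula
doubling-A = ⊓x 0 (⊔x 1 (var 1 ≐ var 0 ·0))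
successor-A = ⊓x 0 (⊔x 1 (var 1 ≐ var 0 ′))

Γ-step : List Formula
Γ-step = Γ-PA ++ ⊓-closure Halve ∷ doubling-A ∷ successor-A ∷ []

Γ-step-provable : All CLA4⊢ Γ-step
Γ-step-provable = ++⁺ Γ-PA-provable (halving ∷ ax-double ∷ ax-succ ∷ [])

Γ-step-sentences : All Sentence Γ-step
Γ-step-sentences = ++⁺ Γ-PA-sentences (refl ∷ refl ∷ refl ∷ [])

-- x = var 203 has been halved into h = var 204
Halved : Bool → Formula
Halved i = SizeLe (var 204) (var 203) `∧ (var 203 ≐ var 204 ·[ i ])

¬IH : Formula
¬IH = `¬ (BoundedAddition (var 200) (var 201) (var 202))

-- The cases of the step, by the new summand T = 2y + j and the parity of x.

step₀-even : CL12⊢ (Γ-PA ++ Halved false ∷ doubling-A ∷ successor-A ∷ [] ∘- ¬IH `∨ Goal (var 202 ·0))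
step₀-even =
  ⊔x-choose′ (∙ ∨ₗ _) (var 204) (
  wait′ (by-Peano λ { M ρ pa ((_ , x≈2h) , _) → IH-applies M ρ pa (double⇒≼ M pa x≈2h) (≼-double M pa _) }) [] []
  (fresh 205 (
    ⊓x-choose′ (Γ-PA ++ _ ∷ []) ∙ (var 205) (
    wait′ (false-antecedent (Γ-PA ++ _ ∷ []) λ _ _ ()) [] [] []
    (fresh 206 (
      ⊔x-choose′ (_ ∨ᵣ (_ ∨ᵣ (_ ∨ᵣ ∙))) (var 206) (
      wait′ (by-Peano λ { M ρ pa ((_ , x≈2h) , w≈2z , _) →
              IH-answers M ρ pa (double⇒≼ M pa x≈2h) (≼-double M pa _) (x+2y≈w pa x≈2h w≈2z) })
        [] [] [] [])) ∷ []))) ∷ []) [])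
  where
  open Arithmetic.PeanoProperties using (double⇒≼; ≼-double)
  module _ {M : Structure} (pa : Arithmetic.Peano M) where
    open Structure M; open Arithmetic M; open PeanoProperties pa
    x+2y≈w : ∀ {x y h z w} → x ≈ mul two h → w ≈ mul two z → z ≈ add h y → w ≈ add x (mul two y)
    x+2y≈w {x} {y} {h} {z} {w} x≈2h w≈2z z≈h+y = begin
      w                            ≈⟨ w≈2z ⟩
      mul two z                    ≈⟨ ≈-cong (mul two) z≈h+y ⟩
      mul two (add h y)            ≈⟨ double-+ h y ⟩
      add (mul two h) (mul two y)  ≈⟨ ≈-cong (λ v → add v (mul two y)) x≈2h ⟨
      add x (mul two y)            ∎

step₀-odd : CL12⊢ (Γ-PA ++ Halved true ∷ doubling-A ∷ successor-A ∷ [] ∘- ¬IH `∨ Goal (var 202 ·0))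
step₀-odd =
  ⊔x-choose′ (∙ ∨ₗ _) (var 204) (
  wait′ (by-Peano λ { M ρ pa ((_ , x≈2h+1) , _) →
          IH-applies M ρ pa (double+1⇒≼ M pa x≈2h+1) (≼-double M pa _) }) [] []
  (fresh 205 (
    ⊓x-choose′ (Γ-PA ++ _ ∷ []) ∙ (var 205) (
    wait′ (false-antecedent (Γ-PA ++ _ ∷ []) λ _ _ ()) [] [] []
    (fresh 206 (
      ⊓x-choose′ (Γ-PA ++ _ ∷ _ ∷ []) ∙ (var 206) (
      wait′ (false-antecedent (Γ-PA ++ _ ∷ _ ∷ []) λ _ _ ()) [] [] []
      (fresh 207 (
        ⊔x-choose′ (_ ∨ᵣ (_ ∨ᵣ (_ ∨ᵣ ∙))) (var 207) (
        wait′ (by-Peano λ { M ρ pa ((_ , x≈2h+1) , v≈2z , w≈v+1) →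
                IH-answers M ρ pa (double+1⇒≼ M pa x≈2h+1) (≼-double M pa _) (x+2y≈w pa x≈2h+1 v≈2z w≈v+1) })
          [] [] [] [])) ∷ []))) ∷ []))) ∷ []) [])
  where
  open Arithmetic.PeanoProperties using (double+1⇒≼; ≼-double)
  module _ {M : Structure} (pa : Arithmetic.Peano M) where
    open Structure M; open Arithmetic M; open Peano pa; open PeanoProperties pa
    x+2y≈w : ∀ {x y h z v w} → x ≈ succ (mul two h) → v ≈ mul two z → w ≈ succ v → z ≈ add h y →
      w ≈ add x (mul two y)
    x+2y≈w {x} {y} {h} {z} {v} {w} x≈2h+1 v≈2z w≈v+1 z≈h+y = begin
      w                                  ≈⟨ w≈v+1 ⟩
      succ v                             ≈⟨ ≈-cong succ v≈2z ⟩
      succ (mul two z)                   ≈⟨ ≈-cong (succ ∘ mul two) z≈h+y ⟩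
      succ (mul two (add h y))           ≈⟨ ≈-cong succ (double-+ h y) ⟩
      succ (add (mul two h) (mul two y)) ≈⟨ suc-+ _ _ ⟨
      add (succ (mul two h)) (mul two y) ≈⟨ ≈-cong (λ u → add u (mul two y)) x≈2h+1 ⟨
      add x (mul two y)                  ∎

step₁-even : CL12⊢ (Γ-PA ++ Halved false ∷ doubling-A ∷ successor-A ∷ [] ∘- ¬IH `∨ Goal (var 202 ·1))
step₁-even =
  ⊔x-choose′ (∙ ∨ₗ _) (var 204) (
  wait′ (by-Peano λ { M ρ pa ((_ , x≈2h) , _) →
          IH-applies M ρ pa (double⇒≼ M pa x≈2h) (≼-double+1 M pa _) }) [] []
  (fresh 205 (
    ⊓x-choose′ (Γ-PA ++ _ ∷ []) ∙ (var 205) (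
    wait′ (false-antecedent (Γ-PA ++ _ ∷ []) λ _ _ ()) [] [] []
    (fresh 206 (
      ⊓x-choose′ (Γ-PA ++ _ ∷ _ ∷ []) ∙ (var 206) (
      wait′ (false-antecedent (Γ-PA ++ _ ∷ _ ∷ []) λ _ _ ()) [] [] []
      (fresh 207 (
        ⊔x-choose′ (_ ∨ᵣ (_ ∨ᵣ (_ ∨ᵣ ∙))) (var 207) (
        wait′ (by-Peano λ { M ρ pa ((_ , x≈2h) , v≈2z , w≈v+1) →
                IH-answers M ρ pa (double⇒≼ M pa x≈2h) (≼-double+1 M pa _) (x+2y+1≈w pa x≈2h v≈2z w≈v+1) })
          [] [] [] [])) ∷ []))) ∷ []))) ∷ []) [])
  where
  open Arithmetic.PeanoProperties using (double⇒≼; ≼-double+1)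
  module _ {M : Structure} (pa : Arithmetic.Peano M) where
    open Structure M; open Arithmetic M; open Peano pa; open PeanoProperties pa
    x+2y+1≈w : ∀ {x y h z v w} → x ≈ mul two h → v ≈ mul two z → w ≈ succ v → z ≈ add h y →
      w ≈ add x (succ (mul two y))
    x+2y+1≈w {x} {y} {h} {z} {v} {w} x≈2h v≈2z w≈v+1 z≈h+y = begin
      w                                  ≈⟨ w≈v+1 ⟩
      succ v                             ≈⟨ ≈-cong succ v≈2z ⟩
      succ (mul two z)                   ≈⟨ ≈-cong (succ ∘ mul two) z≈h+y ⟩
      succ (mul two (add h y))           ≈⟨ ≈-cong succ (double-+ h y) ⟩
      succ (add (mul two h) (mul two y)) ≈⟨ +-suc _ _ ⟨
      add (mul two h) (succ (mul two y)) ≈⟨ ≈-cong (λ u → add u (succ (mul two y))) x≈2h ⟨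
      add x (succ (mul two y))           ∎

-- Here x + 2y + 1 = 2(h + 1 + y), so the IH is used at h + 1 instead.
step₁-odd : CL12⊢ (Γ-PA ++ Halved true ∷ doubling-A ∷ successor-A ∷ [] ∘- ¬IH `∨ Goal (var 202 ·1))
step₁-odd =
  ⊓x-choose′ (Γ-PA ++ _ ∷ _ ∷ []) ∙ (var 204) (
  wait′ (false-antecedent (Γ-PA ++ _ ∷ _ ∷ []) λ _ _ ()) [] [] []
  (fresh 205 (
    ⊔x-choose′ (∙ ∨ₗ _) (var 205) (
    wait′ (by-Peano λ { M ρ pa ((_ , x≈2h+1) , _ , h′≈h+1) →
            IH-applies M ρ pa (h′≼x pa x≈2h+1 h′≈h+1) (≼-double+1 M pa _) }) [] []
    (fresh 206 (
      ⊓x-choose′ (Γ-PA ++ _ ∷ []) ∙ (var 206) (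
      wait′ (false-antecedent (Γ-PA ++ _ ∷ []) λ _ _ ()) [] [] []
      (fresh 207 (
        ⊔x-choose′ (_ ∨ᵣ (_ ∨ᵣ (_ ∨ᵣ ∙))) (var 207) (
        wait′ (by-Peano λ { M ρ pa ((_ , x≈2h+1) , w≈2z , h′≈h+1) →
                IH-answers M ρ pa (h′≼x pa x≈2h+1 h′≈h+1) (≼-double+1 M pa _)
                  (x+2y+1≈w pa x≈2h+1 h′≈h+1 w≈2z) })
          [] [] [] [])) ∷ []))) ∷ []) [])) ∷ []))
  where
  open Arithmetic.PeanoProperties using (≼-double+1)
  module _ {M : Structure} (pa : Arithmetic.Peano M) where
    open Structure M; open Arithmetic M; open Peano pa; open PeanoProperties pa
    h′≼x : ∀ {x h h′} → x ≈ succ (mul two h) → h′ ≈ succ h → h′ ≼ᴹ x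
    h′≼x x≈2h+1 h′≈h+1 = ≼-resp (≈-sym h′≈h+1) (≈-sym x≈2h+1) (≼-suc (≼-double _))
    x+2y+1≈w : ∀ {x y h h′ z w} → x ≈ succ (mul two h) → h′ ≈ succ h → w ≈ mul two z → z ≈ add h′ y →
      w ≈ add x (succ (mul two y))
    x+2y+1≈w {x} {y} {h} {h′} {z} {w} x≈2h+1 h′≈h+1 w≈2z z≈h′+y = begin
      w                                         ≈⟨ w≈2z ⟩
      mul two z                                 ≈⟨ ≈-cong (mul two) z≈h′+y ⟩
      mul two (add h′ y)                        ≈⟨ double-+ h′ y ⟩
      add (mul two h′) (mul two y)              ≈⟨ ≈-cong (λ u → add (mul two u) (mul two y)) h′≈h+1 ⟩
      add (mul two (succ h)) (mul two y)        ≈⟨ ≈-cong (λ u → add u (mul two y)) (double-suc h) ⟩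
      add (succ (succ (mul two h))) (mul two y) ≈⟨ suc-+ _ _ ⟩
      succ (add (succ (mul two h)) (mul two y)) ≈⟨ +-suc _ _ ⟨
      add (succ (mul two h)) (succ (mul two y)) ≈⟨ ≈-cong (λ u → add u (succ (mul two y))) x≈2h+1 ⟨
      add x (succ (mul two y))                  ∎

addition-step₀ : CL12⊢ (Γ-step ∘- ⊓-closure (Addition ⇒ substF 34 (var 34 ·0) Addition))
addition-step₀ =
  wait′ (⊨∥-intro λ _ _ _ → tt) [] [] (fresh 200 (
  wait′ (⊨∥-intro λ _ _ _ → tt) [] [] (fresh 201 (
  wait′ (⊨∥-intro λ _ _ _ → tt) [] [] (fresh 202 (
  wait′ (⊨∥-intro λ _ _ _ → ∨-introʳ tt) [] [] (fresh 203 (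
  ⊓x-choose′ Γ-PA ∙ (var 203) (
  wait′ (false-antecedent Γ-PA λ _ _ ()) [] [] [] (fresh 204 (
  wait′ (false-antecedent Γ-PA λ { _ _ (_ , ()) }) [] (both step₀-even step₀-odd ∷ []) [] []
  ) ∷ []))) ∷ []) []) ∷ []) []) ∷ []) []) ∷ []) []

addition-step₁ : CL12⊢ (Γ-step ∘- ⊓-closure (Addition ⇒ substF 34 (var 34 ·1) Addition))
addition-step₁ =
  wait′ (⊨∥-intro λ _ _ _ → tt) [] [] (fresh 200 (
  wait′ (⊨∥-intro λ _ _ _ → tt) [] [] (fresh 201 (
  wait′ (⊨∥-intro λ _ _ _ → tt) [] [] (fresh 202 (
  wait′ (⊨∥-intro λ _ _ _ → ∨-introʳ tt) [] [] (fresh 203 (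
  ⊓x-choose′ Γ-PA ∙ (var 203) (
  wait′ (false-antecedent Γ-PA λ _ _ ()) [] [] [] (fresh 204 (
  wait′ (false-antecedent Γ-PA λ { _ _ (_ , ()) }) [] (both step₁-even step₁-odd ∷ []) [] []
  ) ∷ []))) ∷ []) []) ∷ []) []) ∷ []) []) ∷ []) []

addition : CLA4⊢ (⊓-closure Addition)
addition = cla4-induction Addition 34 Addition-polyBounded
  (logical-consequence Γ-PA _ Γ-PA-provable Γ-PA-sentences refl addition-base)
  (logical-consequence Γ-step _ Γ-step-provable Γ-step-sentences refl addition-step₀)
  (logical-consequence Γ-step _ Γ-step-provable Γ-step-sentences refl addition-step₁)

-- With a, b := x, y both operands are small, so Addition computes x + y.
sum : CL12⊢ (Γ-PA ++ ⊓-closure Addition ∷ [] ∘- ⊓x 0 (⊓x 1 (⊔x 2 (var 2 ≐ var 0 `+ var 1))))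
sum =
  wait′ (⊨∥-intro λ _ _ _ → tt) [] [] (fresh 200 (
  wait′ (⊨∥-intro λ _ _ _ → tt) [] [] (fresh 201 (
  ⊓x-choose′ Γ-PA ∙ (var 200) (⊓x-choose′ Γ-PA ∙ (var 201) (
  ⊓x-choose′ Γ-PA ∙ (var 201) (⊓x-choose′ Γ-PA ∙ (var 200) (
  wait′ (by-Peano λ M ρ pa addition-at → answer-at-x+y M ρ pa {`⊥} addition-at) [] [] []
  (fresh 202 (⊔x-choose′ ∙ (var 202) (
    wait′ (by-Peano λ M ρ pa addition-at →
      proj₂ (answer-at-x+y M ρ pa {Small (var 202) `∧ (var 202 ≐ var 200 `+ var 201)} addition-at)) [] [] [] [])
  ) ∷ [])))))) ∷ []) []) ∷ []) []
  where
  answer-at-x+y : ∀ M ρ → Arithmetic.Peano M → {G : Formula} →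
    ⟦ M ⟧ (Small (var 200) ⇒ (Small (var 200 `+ var 201) ⇒ G)) ρ → ⟦ M ⟧ G ρ
  answer-at-x+y M ρ pa {G} h =
    ⇒-elim (Small (var 200 `+ var 201)) G ρ
      (⇒-elim (Small (var 200)) (Small (var 200 `+ var 201) ⇒ G) ρ h (proj₁ small)) (proj₂ small)
    where
    open Classical M
    open Arithmetic M
    small : SizeLeSumᴹ (ρ 200) (ρ 200) (ρ 201) × SizeLeSumᴹ (Structure.add M (ρ 200) (ρ 201)) (ρ 200) (ρ 201)
    small = PeanoProperties.summands-small pa (ρ 200) (ρ 201)

fact12p4 : CLA4⊢ (⊓x 0 (⊓x 1 (⊔x 2 (var 2 ≐ var 0 `+ var 1))))
fact12p4 = logical-consequence (Γ-PA ++ ⊓-closure Addition ∷ []) _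
  (++⁺ Γ-PA-provable (addition ∷ [])) (++⁺ Γ-PA-sentences (refl ∷ [])) refl sum
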